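{- Fix $\varepsilon>0$ with $m:=1/\varepsilon^3$ an integer (so $1/\varepsilon$ is an integer). Let an instance of $\mathsf{GCBP}$ with items $\mathsf{T}=\{1,\dots,n\}$, sizes $s_i$ and cost function $f$ be given, with optimal cost $f(\mathsf{OPT})$. Order the items as $x_1,x_2,\dots,x_n$ in non-increasing order of size, breaking ties in favor of smaller index (position $p$ holds item $x_p$). Then there exist an integer $\Pi\in\{0,1,\dots,n\}$ and integers $1\le t_1\le t_2\le\dots\le t_m\le t_{m+1}:=n+1$ such that, defining for $i\in\{1,\dots,m\}$ $$\pi_i=\lfloor \Pi/m\rfloor+\mathbf{1}[\,i\le \Pi \bmod m\,]$$ (so $\pi_1=\lceil \varepsilon^3\Pi\rceil\ge\pi_2\ge\dots\ge\pi_m=\lfloor\varepsilon^3\Pi\rfloor$ and $\sum_i\pi_i=\Pi$), the groups $\Gamma_i=\{x_p: t_i\le p<t_{i+1}\}$ satisfy $|\Gamma_i|\ge\pi_i$, and, letting the class $\Psi_i=\{x_p: t_i\le p<t_i+\pi_i\}$ be the $\pi_i$ largest items of $\Gamma_i$ and $\Psi=\bigcup_{i=1}^m\Psi_i$ (so $|\Psi|=\Pi$), the following holds. Assign to every item of $\Psi_i$ the rounded size $s_{x_{t_i}}$ (for $i$ with $\pi_i>0$), and to every item not in $\Psi$ its original size. Then there is a partition of $\mathsf{T}$ into bins such that: the total rounded size of the items in each bin is at most $1$; every bin containing an item of $\Psi$ contains only items of $\Psi$ and at most $1/\varepsilon^2$ items; every bin containing an item of $\mathsf{T}\setminus\Psi$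 contains only items of $\mathsf{T}\setminus\Psi$ and strictly more than $1/\varepsilon^2$ items; and the total cost $\sum_{B}f(|B|)$ of this partition is at most $(1+\varepsilon)f(\mathsf{OPT})+1$.
   Context: Bin packing with general cost structures ($\mathsf{GCBP}$): an instance consists of a set of items $\mathsf{T}=\{1,\dots,n\}$, each item $i$ having a rational size $s_i\in[0,1]$, and a cost function $f:\{0,1,\dots,n\}\to\mathbb{Q}_{\ge 0}$ that is monotone non-decreasing with $f(0)=0$ and $f(1)=1$. A feasible solution is a partition of $\mathsf{T}$ into bins $\mathsf{B}_1,\dots,\mathsf{B}_{k'}$ with $\sum_{i\in\mathsf{B}_j}s_i\le1$ for all $j$; its cost is $\sum_j f(|\mathsf{B}_j|)$; $f(\mathsf{OPT})$ denotes the minimum cost. A bin is called sparse if it contains between $1$ and $1/\varepsilon^2$ items and dense if it contains more than $1/\varepsilon^2$ items. In the paper, a pair (sparse-instance cardinality $\Pi$, breakpoint guess determining the groups $\Gamma_i$) is enumerated by the algorithm; the set $\Psi$ (with rounded sizes) is the "sparse instance" and $\mathsf{T}\setminus\Psi$ the "dense instance". -}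

module Defs where

open import Data.Nat as ℕ using (ℕ; zero; suc; NonZero; _<ᵇ_)
open import Data.Nat.Properties using (m*n≢0)
open import Data.Bool using (if_then_else_)
open import Data.Fin as Fin using (Fin; toℕ)
open import Data.Rational as ℚ using (ℚ; 0ℚ; 1ℚ)
open import Relation.Nullary using (does)
open import Function using (_∘_)

sumℚ : ∀ {n} → (Fin n → ℚ) → ℚ
sumℚ {zero}  g = 0ℚ
sumℚ {suc n} g = g Fin.zero ℚ.+ sumℚ (g ∘ Fin.suc)

binCount : ∀ {n k} → (Fin n → Fin k) → Fin k → ℕ
binCount {zero}  a j = 0
binCount {suc n} a j =
  (if does (a Fin.zero Fin.≟ j) then 1 else 0) ℕ.+ binCount (a ∘ Fin.suc) j

binLoad : ∀ {n k} → (Fin n → ℚ) → (Fin n → Fin k) → Fin k → ℚ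
binLoad {zero}  sz a j = 0ℚ
binLoad {suc n} sz a j =
  (if does (a Fin.zero Fin.≟ j) then sz Fin.zero else 0ℚ)
    ℚ.+ binLoad (sz ∘ Fin.suc) (a ∘ Fin.suc) j

-- A partition of the items T = Fin n into (at most) k labelled bins,
-- given as an assignment item ↦ bin.  Empty labels are allowed; they cost f 0 = 0.
Feasible : ∀ {n k} → (Fin n → ℚ) → (Fin n → Fin k) → Set
Feasible sz a = ∀ j → binLoad sz a j ℚ.≤ 1ℚ

cost : ∀ {n k} → (ℕ → ℚ) → (Fin n → Fin k) → ℚ
cost f a = sumℚ (λ j → f (binCount a j))

CostFunction : ℕ → (ℕ → ℚ) → Set
CostFunction n f =
  (f 0 ≡ 0ℚ) × (f 1 ≡ 1ℚ)
  × (∀ x → x ℕ.≤ n → 0ℚ ℚ.≤ f x)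
  × (∀ x y → x ℕ.≤ y → y ℕ.≤ n → f x ℚ.≤ f y)
  where open import Relation.Binary.PropositionalEquality using (_≡_)
        open import Data.Product using (_×_)

-- σ : position ↦ item is the ordering of the items by non-increasing size,
-- ties broken in favour of the smaller index.  Positions are 0-based.
SortedOrder : ∀ {n} → (Fin n → ℚ) → (Fin n → Fin n) → Set
SortedOrder {n} s σ =
  (∀ p q → σ p ≡ σ q → p ≡ q)
  × (∀ (p q : Fin n) → p Fin.< q →
       (s (σ q) ℚ.< s (σ p)) ⊎ ((s (σ p) ≡ s (σ q)) × (σ p Fin.< σ q)))
  where open import Relation.Binary.PropositionalEquality using (_≡_)
        open import Data.Product using (_×_)
        open import Data.Sum using (_⊎_)

-- m = 1/ε³ where ε = 1/k.
cube : ℕ → ℕ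
cube k = k ℕ.* k ℕ.* k

-- π_i = ⌊Π/m⌋ + 1[i ≤ Π mod m] for the 1-based index i = toℕ i' + 1.
piSize : (k : ℕ) → .{{NonZero k}} → (Π : ℕ) → Fin (cube k) → ℕ
piSize k Π i =
  let instance _ = m*n≢0 (k ℕ.* k) k {{m*n≢0 k k}} in
  (Π ℕ./ cube k) ℕ.+ (if toℕ i <ᵇ (Π ℕ.% cube k) then 1 else 0)

-- Position p (0-based) lies in the class Ψ_i for some i, given the breakpoints
-- t (t (inject₁ i) is the 0-based first position of group Γ_i).
InΨ : (k : ℕ) → .{{NonZero k}} → (Π : ℕ) → (Fin (suc (cube k)) → ℕ) → ℕ → Set
InΨ k Π t p =
  Σ (Fin (cube k)) λ i →
    (t (Fin.inject₁ i) ℕ.≤ p) × (p ℕ.< t (Fin.inject₁ i) ℕ.+ piSize k Π i)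
  where open import Data.Product using (Σ; _×_)

{-# OPTIONS --safe #-}
module Submission where

-- Let S be the set of positions (in the sorted order) whose item lies in a sparse bin of
-- the packing O, and Π = |S|.  Cutting S by rank into k³ runs of sizes π₀ ≥ π₁ ≥ …
-- (differing by at most one) gives the breakpoints tᵢ, the position of the first element
-- of run i, and Ψ is the union of the blocks [tᵢ, tᵢ + πᵢ).  Every prefix of positions
-- contains at least as many points of Ψ as of S.  Hence there is a permutation of the
-- positions mapping Ψ onto S and its complement onto the complement of S, moving no point
-- outside Ψ to the right and, as it shifts ranks within Ψ down by π₀, moving every point of
-- a block i ≥ 1 strictly to the left of tᵢ.  Sizes decrease along the positions, so every
-- item outside Ψ₀ = [t₀, t₀ + π₀) is, with its rounded size, no larger than its partner and
-- can take the partner's place in O; the items of Ψ₀ get bins of their own.  Sparse bins of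
-- O then receive only items of Ψ, and dense bins exactly as many items outside Ψ as before.
-- The cost grows by at most π₀ ≤ Π/k³ + 1, and Π ≤ k²·B where B ≤ f(O) counts the non-empty
-- sparse bins of O, so π₀ ≤ f(O)/k + 1.

module Counting where

  open import Level using (0ℓ)
  open import Data.Nat.Base
  open import Data.Nat.Properties
  open import Algebra.Properties.CommutativeSemigroup +-commutativeSemigroup using (interchange)
  open import Data.Product using (∃-syntax; _×_; _,_)
  open import Data.Sum using (inj₁; inj₂)
  open import Relation.Binary.Definitions using (tri<; tri≈; tri>)
  open import Relation.Binary.PropositionalEquality
  open import Relation.Nullary using (Dec; yes; no; ¬_; contradiction; _⊎-dec_)
  open import Relation.Unary using (Pred; Decidable)
  open import Relation.Unary.Properties using (∁?; _∪?_)

  indicator : ∀ {A : Set} → Dec A → ℕ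
  indicator (yes _) = 1
  indicator (no _)  = 0

  indicator-cong : ∀ {A B : Set} → (A → B) → (B → A) → (a? : Dec A) (b? : Dec B) → indicator a? ≡ indicator b?
  indicator-cong A⇒B B⇒A (yes _) (yes _) = refl
  indicator-cong A⇒B B⇒A (yes a) (no ¬b) = contradiction (A⇒B a) ¬b
  indicator-cong A⇒B B⇒A (no ¬a) (yes b) = contradiction (B⇒A b) ¬a
  indicator-cong A⇒B B⇒A (no _)  (no _)  = refl

  count : {P : Pred ℕ 0ℓ} → Decidable P → ℕ → ℕ
  count P? zero    = 0
  count P? (suc x) = indicator (P? x) + count P? x

  module _ {P : Pred ℕ 0ℓ} (P? : Decidable P) where

    count-yes : ∀ {x} → P x → count P? (suc x) ≡ suc (count P? x)
    count-yes {x} px with P? x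
    ... | yes _   = refl
    ... | no ¬px = contradiction px ¬px

    count-suc-≤ : ∀ x → count P? (suc x) ≤ suc (count P? x)
    count-suc-≤ x with P? x
    ... | yes _ = ≤-refl
    ... | no _  = n≤1+n _

    count-≤-suc : ∀ x → count P? x ≤ count P? (suc x)
    count-≤-suc x = m≤n+m (count P? x) (indicator (P? x))

    count-mono : ∀ {x y} → x ≤ y → count P? x ≤ count P? y
    count-mono {y = zero}  z≤n = ≤-refl
    count-mono {y = suc y} x≤1+y with m≤n⇒m<n∨m≡n x≤1+y
    ... | inj₁ x<1+y = ≤-trans (count-mono (s≤s⁻¹ x<1+y)) (count-≤-suc y)
    ... | inj₂ refl  = ≤-refl

    count-≤-+∸ : ∀ {x y} → x ≤ y → count P? y ≤ count P? x + (y ∸ x)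
    count-≤-+∸ {y = zero}  z≤n = ≤-refl
    count-≤-+∸ {x} {suc y} x≤1+y with m≤n⇒m<n∨m≡n x≤1+y
    ... | inj₂ refl = m≤m+n _ _
    ... | inj₁ x<1+y = begin
      count P? (suc y)              ≤⟨ count-suc-≤ y ⟩
      suc (count P? y)              ≤⟨ s≤s (count-≤-+∸ x≤y) ⟩
      suc (count P? x + (y ∸ x))    ≡⟨ +-suc _ _ ⟨
      count P? x + suc (y ∸ x)      ≡⟨ cong (count P? x +_) (+-∸-assoc 1 x≤y) ⟨
      count P? x + (suc y ∸ x)      ∎
      where
      open ≤-Reasoning
      x≤y = s≤s⁻¹ x<1+y

    count-≤ : ∀ x → count P? x ≤ x
    count-≤ x = count-≤-+∸ z≤n

    count-strict : ∀ {x y} → P x → x < y → count P? x < count P? y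
    count-strict px x<y = ≤-trans (≤-reflexive (sym (count-yes px))) (count-mono x<y)

    count-<⇒< : ∀ {x y} → count P? x < count P? y → x < y
    count-<⇒< {x} {y} cx<cy with x <? y
    ... | yes x<y = x<y
    ... | no x≮y  = contradiction (count-mono (≮⇒≥ x≮y)) (<⇒≱ cx<cy)

    count-injective : ∀ {x y} → P x → P y → count P? x ≡ count P? y → x ≡ y
    count-injective px py cx≡cy with <-cmp _ _
    ... | tri< x<y _ _ = contradiction cx≡cy (<⇒≢ (count-strict px x<y))
    ... | tri≈ _ x≡y _ = x≡y
    ... | tri> _ _ y<x = contradiction (sym cx≡cy) (<⇒≢ (count-strict py y<x))

    select : ∀ y {j} → j < count P? y → ∃[ x ] x < y × P x × count P? x ≡ j
    select (suc y) {j} j<c with P? y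
    ... | no _ = let x , x<y , px , cx = select y j<c in x , m<n⇒m<1+n x<y , px , cx
    ... | yes py with m<1+n⇒m<n∨m≡n j<c
    ...   | inj₂ refl = y , ≤-refl , py , refl
    ...   | inj₁ j<cy = let x , x<y , px , cx = select y j<cy in x , m<n⇒m<1+n x<y , px , cx

    count-∁ : ∀ x → count (∁? P?) x + count P? x ≡ x
    count-∁ zero = refl
    count-∁ (suc x) with P? x
    ... | yes _ = trans (+-suc _ _) (cong suc (count-∁ x))
    ... | no _  = cong suc (count-∁ x)

  module _ {P Q : Pred ℕ 0ℓ} (P? : Decidable P) (Q? : Decidable Q) where

    count-∪ : (∀ {x} → P x → ¬ Q x) → ∀ y → count (P? ∪? Q?) y ≡ count P? y + count Q? y
    count-∪ disjoint zero = refl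
    count-∪ disjoint (suc y) = begin
      indicator (P? y ⊎-dec Q? y) + count (P? ∪? Q?) y
        ≡⟨ cong₂ _+_ (indicator-⊎ (P? y) (Q? y)) (count-∪ disjoint y) ⟩
      (indicator (P? y) + indicator (Q? y)) + (count P? y + count Q? y)
        ≡⟨ interchange (indicator (P? y)) (indicator (Q? y)) (count P? y) (count Q? y) ⟩
      (indicator (P? y) + count P? y) + (indicator (Q? y) + count Q? y) ∎
      where
      open ≡-Reasoning
      indicator-⊎ : (p? : Dec (P y)) (q? : Dec (Q y)) → indicator (p? ⊎-dec q?) ≡ indicator p? + indicator q?
      indicator-⊎ (yes p) (yes q) = contradiction q (disjoint p)
      indicator-⊎ (yes _) (no _)  = refl
      indicator-⊎ (no _)  (yes _) = refl
      indicator-⊎ (no _)  (no _)  = refl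

    count-cong : (∀ {x} → P x → Q x) → (∀ {x} → Q x → P x) → ∀ y → count P? y ≡ count Q? y
    count-cong P⇒Q Q⇒P zero    = refl
    count-cong P⇒Q Q⇒P (suc y) = cong₂ _+_ (indicator-cong P⇒Q Q⇒P (P? y) (Q? y)) (count-cong P⇒Q Q⇒P y)

    count-∁-antitone : ∀ {y} → count P? y ≤ count Q? y → count (∁? Q?) y ≤ count (∁? P?) y
    count-∁-antitone {y} P≤Q = +-cancelʳ-≤ (count P? y) _ _ (begin
      count (∁? Q?) y + count P? y   ≤⟨ +-monoʳ-≤ (count (∁? Q?) y) P≤Q ⟩
      count (∁? Q?) y + count Q? y   ≡⟨ count-∁ Q? y ⟩
      y                              ≡⟨ count-∁ P? y ⟨
      count (∁? P?) y + count P? y   ∎)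
      where open ≤-Reasoning

module Blocks where

  open import Level using (0ℓ)
  open import Data.Nat.Base
  open import Data.Nat.Properties
  open import Data.Product using (∃-syntax; _×_; _,_)
  open import Data.Sum using (_⊎_; inj₁; inj₂)
  open import Relation.Binary.PropositionalEquality
  open import Relation.Nullary using (Dec; yes; no; ¬_; _×-dec_)
  open import Relation.Unary using (Pred; Decidable)
  open import Relation.Unary.Properties using (_∪?_)
  open Counting

  InBlock : ℕ → ℕ → Pred ℕ 0ℓ
  InBlock t π x = t ≤ x × x < t + π

  inBlock? : ∀ t π → Decidable (InBlock t π)
  inBlock? t π x = t ≤? x ×-dec x <? t + π

  count-inBlock : ∀ t π y → count (inBlock? t π) y ≡ (y ∸ t) ⊓ π
  count-inBlock t π zero = cong (_⊓ π) (sym (0∸n≡0 t))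
  count-inBlock t π (suc y) = trans (cong (indicator (inBlock? t π y) +_) (count-inBlock t π y)) (step (t ≤? y) (y <? t + π))
    where
    step : (t≤? : Dec (t ≤ y)) (y<? : Dec (y < t + π)) → indicator (t≤? ×-dec y<?) + (y ∸ t) ⊓ π ≡ (suc y ∸ t) ⊓ π
    step (no t≰y) _ = cong (_⊓ π) (trans (m≤n⇒m∸n≡0 (<⇒≤ t>y)) (sym (m≤n⇒m∸n≡0 t>y)))
      where t>y = ≰⇒> t≰y
    step (yes t≤y) (yes y<t+π) = begin
      suc ((y ∸ t) ⊓ π)   ≡⟨ cong suc (m≤n⇒m⊓n≡m (<⇒≤ y∸t<π)) ⟩
      suc (y ∸ t)         ≡⟨ m≤n⇒m⊓n≡m y∸t<π ⟨
      suc (y ∸ t) ⊓ π     ≡⟨ cong (_⊓ π) (+-∸-assoc 1 t≤y) ⟨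
      (suc y ∸ t) ⊓ π     ∎
      where
      open ≡-Reasoning
      y∸t<π = subst (y ∸ t <_) (m+n∸m≡n t π) (∸-monoˡ-< y<t+π t≤y)
    step (yes t≤y) (no y≮t+π) =
      trans (m≥n⇒m⊓n≡n π≤y∸t) (sym (m≥n⇒m⊓n≡n (≤-trans π≤y∸t (∸-monoˡ-≤ t (n≤1+n y)))))
      where π≤y∸t = m+n≤o⇒m≤o∸n π (≤-trans (≤-reflexive (+-comm π t)) (≮⇒≥ y≮t+π))

  prefixSum : (ℕ → ℕ) → ℕ → ℕ
  prefixSum π zero    = 0
  prefixSum π (suc i) = prefixSum π i + π i

  prefixSum-mono : ∀ π {i j} → i ≤ j → prefixSum π i ≤ prefixSum π j
  prefixSum-mono π {j = zero}  z≤n = ≤-refl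
  prefixSum-mono π {i} {suc j} i≤1+j with m≤n⇒m<n∨m≡n i≤1+j
  ... | inj₁ i<1+j = ≤-trans (prefixSum-mono π (s≤s⁻¹ i<1+j)) (m≤m+n _ _)
  ... | inj₂ refl  = ≤-refl

  module OrderedBlocks (m : ℕ) (t π : ℕ → ℕ) (ordered : ∀ {i} → i < m → t i + π i ≤ t (suc i)) where

    t-suc-mono : ∀ {i} → i < m → t i ≤ t (suc i)
    t-suc-mono {i} i<m = ≤-trans (m≤m+n (t i) (π i)) (ordered i<m)

    t-mono : ∀ {i j} → i ≤ j → j ≤ m → t i ≤ t j
    t-mono {j = zero}  z≤n _ = ≤-refl
    t-mono {i} {suc j} i≤1+j 1+j≤m with m≤n⇒m<n∨m≡n i≤1+j
    ... | inj₁ i<1+j = ≤-trans (t-mono (s≤s⁻¹ i<1+j) (<⇒≤ 1+j≤m)) (t-suc-mono 1+j≤m)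
    ... | inj₂ refl  = ≤-refl

    InBlocks : ℕ → Pred ℕ 0ℓ
    InBlocks i x = ∃[ j ] j < i × InBlock (t j) (π j) x

    inBlocks? : ∀ i → Decidable (InBlocks i)
    inBlocks? i x = anyUpTo? (λ j → inBlock? (t j) (π j) x) i

    inBlocks-< : ∀ {i x} → i ≤ m → InBlocks i x → x < t i
    inBlocks-< i≤m (j , j<i , _ , x<end) = ≤-trans x<end (≤-trans (ordered (≤-trans j<i i≤m)) (t-mono j<i i≤m))

    count-inBlocks-zero : ∀ y → count (inBlocks? 0) y ≡ 0
    count-inBlocks-zero zero    = refl
    count-inBlocks-zero (suc y) = count-inBlocks-zero y

    count-inBlocks-suc : ∀ {i} → i < m → ∀ y → count (inBlocks? (suc i)) y ≡ count (inBlocks? i) y + (y ∸ t i) ⊓ π i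
    count-inBlocks-suc {i} i<m y = begin
      count (inBlocks? (suc i)) y
        ≡⟨ count-cong (inBlocks? (suc i)) (inBlocks? i ∪? inBlock? (t i) (π i)) split join y ⟩
      count (inBlocks? i ∪? inBlock? (t i) (π i)) y            ≡⟨ count-∪ (inBlocks? i) (inBlock? (t i) (π i)) disjoint y ⟩
      count (inBlocks? i) y + count (inBlock? (t i) (π i)) y   ≡⟨ cong (count (inBlocks? i) y +_) (count-inBlock (t i) (π i) y) ⟩
      count (inBlocks? i) y + (y ∸ t i) ⊓ π i                  ∎
      where
      open ≡-Reasoning
      split : ∀ {x} → InBlocks (suc i) x → InBlocks i x ⊎ InBlock (t i) (π i) x
      split (j , j<1+i , b) with m<1+n⇒m<n∨m≡n j<1+i
      ... | inj₁ j<i  = inj₁ (j , j<i , b)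
      ... | inj₂ refl = inj₂ b
      join : ∀ {x} → InBlocks i x ⊎ InBlock (t i) (π i) x → InBlocks (suc i) x
      join (inj₁ (j , j<i , b)) = j , m<n⇒m<1+n j<i , b
      join (inj₂ b)             = i , ≤-refl , b
      disjoint : ∀ {x} → InBlocks i x → ¬ InBlock (t i) (π i) x
      disjoint x∈ (t≤x , _) = <⇒≱ (inBlocks-< (<⇒≤ i<m) x∈) t≤x

    count-inBlocks-complete : ∀ {i y} → i ≤ m → t i ≤ y → count (inBlocks? i) y ≡ prefixSum π i
    count-inBlocks-complete {zero}  {y} _   _   = count-inBlocks-zero y
    count-inBlocks-complete {suc i} {y} i<m t≤y = begin
      count (inBlocks? (suc i)) y               ≡⟨ count-inBlocks-suc i<m y ⟩
      count (inBlocks? i) y + (y ∸ t i) ⊓ π i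
        ≡⟨ cong₂ _+_ (count-inBlocks-complete (<⇒≤ i<m) ti≤y) (m≥n⇒m⊓n≡n π≤y∸t) ⟩
      prefixSum π i + π i                       ∎
      where
      open ≡-Reasoning
      ti≤y = ≤-trans (t-suc-mono i<m) t≤y
      π≤y∸t : π i ≤ y ∸ t i
      π≤y∸t = m+n≤o⇒m≤o∸n (π i) (≤-trans (≤-reflexive (+-comm (π i) (t i))) (≤-trans (ordered i<m) t≤y))

    count-inBlocks-mono : ∀ {i j} → i ≤ j → j ≤ m → ∀ y → count (inBlocks? i) y ≤ count (inBlocks? j) y
    count-inBlocks-mono {j = zero}  z≤n _ y = ≤-refl
    count-inBlocks-mono {i} {suc j} i≤1+j 1+j≤m y with m≤n⇒m<n∨m≡n i≤1+j
    ... | inj₂ refl  = ≤-refl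
    ... | inj₁ i<1+j = begin
      count (inBlocks? i) y                       ≤⟨ count-inBlocks-mono (s≤s⁻¹ i<1+j) (<⇒≤ 1+j≤m) y ⟩
      count (inBlocks? j) y                       ≤⟨ m≤m+n _ _ ⟩
      count (inBlocks? j) y + (y ∸ t j) ⊓ π j     ≡⟨ count-inBlocks-suc 1+j≤m y ⟨
      count (inBlocks? (suc j)) y                 ∎
      where open ≤-Reasoning

    count-inBlocks-stable : ∀ {i j y} → i ≤ j → j ≤ m → y ≤ t i → count (inBlocks? j) y ≡ count (inBlocks? i) y
    count-inBlocks-stable {j = zero}  z≤n _ _ = refl
    count-inBlocks-stable {i} {suc j} {y} i≤1+j 1+j≤m y≤t with m≤n⇒m<n∨m≡n i≤1+j
    ... | inj₂ refl  = refl
    ... | inj₁ i<1+j = begin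
      count (inBlocks? (suc j)) y                 ≡⟨ count-inBlocks-suc 1+j≤m y ⟩
      count (inBlocks? j) y + (y ∸ t j) ⊓ π j     ≡⟨ cong (λ d → count (inBlocks? j) y + d ⊓ π j) (m≤n⇒m∸n≡0 y≤tj) ⟩
      count (inBlocks? j) y + 0                   ≡⟨ +-identityʳ _ ⟩
      count (inBlocks? j) y                       ≡⟨ count-inBlocks-stable i≤j (<⇒≤ 1+j≤m) y≤t ⟩
      count (inBlocks? i) y                       ∎
      where
      open ≡-Reasoning
      i≤j = s≤s⁻¹ i<1+j
      y≤tj = ≤-trans y≤t (t-mono i≤j (<⇒≤ 1+j≤m))

    count-inBlocks-inside : ∀ {i x} → i < m → InBlock (t i) (π i) x → count (inBlocks? m) x ≡ prefixSum π i + (x ∸ t i)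
    count-inBlocks-inside {i} {x} i<m (t≤x , x<end) = begin
      count (inBlocks? m) x                     ≡⟨ count-inBlocks-stable i<m ≤-refl x≤t ⟩
      count (inBlocks? (suc i)) x               ≡⟨ count-inBlocks-suc i<m x ⟩
      count (inBlocks? i) x + (x ∸ t i) ⊓ π i
        ≡⟨ cong₂ _+_ (count-inBlocks-complete (<⇒≤ i<m) t≤x) (m≤n⇒m⊓n≡m (<⇒≤ x∸t<π)) ⟩
      prefixSum π i + (x ∸ t i)                 ∎
      where
      open ≡-Reasoning
      x≤t = <⇒≤ (≤-trans x<end (ordered i<m))
      x∸t<π = subst (x ∸ t i <_) (m+n∸m≡n (t i) (π i)) (∸-monoˡ-< x<end t≤x)

    module _ {Q : Pred ℕ 0ℓ} (Q? : Decidable Q) (count-at-t : ∀ {i} → i ≤ m → count Q? (t i) ≡ prefixSum π i) where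

      count-dominated : ∀ {j x} → j ≤ m → x ≤ t j → count Q? x ≤ count (inBlocks? j) x
      count-dominated {zero} {x} _ x≤t = ≤-trans (count-mono Q? x≤t) (≤-trans (≤-reflexive (count-at-t z≤n)) z≤n)
      count-dominated {suc j} {x} j<m x≤t with x ≤? t j
      ... | yes x≤tj = ≤-trans (count-dominated (<⇒≤ j<m) x≤tj) (count-inBlocks-mono (n≤1+n j) j<m x)
      ... | no x≰tj = begin
        count Q? x                                  ≤⟨ ⊓-glb below-start below-end ⟩
        (prefixSum π j + (x ∸ t j)) ⊓ (prefixSum π j + π j)   ≡⟨ +-distribˡ-⊓ (prefixSum π j) _ _ ⟨
        prefixSum π j + (x ∸ t j) ⊓ π j             ≡⟨ cong (_+ (x ∸ t j) ⊓ π j) (count-inBlocks-complete (<⇒≤ j<m) tj≤x) ⟨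
        count (inBlocks? j) x + (x ∸ t j) ⊓ π j     ≡⟨ count-inBlocks-suc j<m x ⟨
        count (inBlocks? (suc j)) x                 ∎
        where
        open ≤-Reasoning
        tj≤x = <⇒≤ (≰⇒> x≰tj)
        below-start : count Q? x ≤ prefixSum π j + (x ∸ t j)
        below-start = subst (λ c → count Q? x ≤ c + (x ∸ t j)) (count-at-t (<⇒≤ j<m)) (count-≤-+∸ Q? tj≤x)
        below-end : count Q? x ≤ prefixSum π j + π j
        below-end = ≤-trans (count-mono Q? x≤t) (≤-reflexive (count-at-t j<m))

module Breakpoints where

  open import Level using (0ℓ)
  open import Data.Bool.Base using (true; false; if_then_else_)
  open import Data.Nat.Base
  open import Data.Nat.Properties
  open import Algebra.Properties.CommutativeSemigroup +-commutativeSemigroup using (interchange)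
  open import Data.Nat.DivMod using (_/_; _%_; m≡m%n+[m/n]*n; m%n<n)
  open import Data.Product using (_×_; _,_; proj₁; proj₂)
  open import Data.Sum using (_⊎_; inj₁; inj₂)
  open import Relation.Binary.PropositionalEquality
  open import Relation.Nullary using (yes; no; contradiction)
  open import Relation.Unary using (Pred; Decidable)
  open Counting
  open Blocks

  module GroupSizes (m : ℕ) .{{_ : NonZero m}} (Π : ℕ) where

    groupSize : ℕ → ℕ
    groupSize i = Π / m + (if i <ᵇ Π % m then 1 else 0)

    private
      suc-⊓ : ∀ i r → suc i ⊓ r ≡ i ⊓ r + (if i <ᵇ r then 1 else 0)
      suc-⊓ zero    zero    = refl
      suc-⊓ zero    (suc r) = refl
      suc-⊓ (suc i) zero    = refl
      suc-⊓ (suc i) (suc r) = cong suc (suc-⊓ i r)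

    prefixSum-groupSize : ∀ i → prefixSum groupSize i ≡ i * (Π / m) + i ⊓ (Π % m)
    prefixSum-groupSize zero    = refl
    prefixSum-groupSize (suc i) = begin
      prefixSum groupSize i + groupSize i                  ≡⟨ cong (_+ groupSize i) (prefixSum-groupSize i) ⟩
      (i * q + i ⊓ r) + (q + (if i <ᵇ r then 1 else 0))    ≡⟨ interchange (i * q) (i ⊓ r) q _ ⟩
      (i * q + q) + (i ⊓ r + (if i <ᵇ r then 1 else 0))    ≡⟨ cong₂ _+_ (+-comm (i * q) q) (sym (suc-⊓ i r)) ⟩
      suc i * q + suc i ⊓ r                                ∎
      where
      open ≡-Reasoning
      q = Π / m
      r = Π % m

    prefixSum-groupSize-m : prefixSum groupSize m ≡ Π
    prefixSum-groupSize-m = begin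
      prefixSum groupSize m           ≡⟨ prefixSum-groupSize m ⟩
      m * (Π / m) + m ⊓ (Π % m)       ≡⟨ cong₂ _+_ (*-comm m (Π / m)) (m≥n⇒m⊓n≡n (<⇒≤ (m%n<n Π m))) ⟩
      Π / m * m + Π % m               ≡⟨ +-comm _ (Π % m) ⟩
      Π % m + Π / m * m               ≡⟨ m≡m%n+[m/n]*n Π m ⟨
      Π                               ∎
      where open ≡-Reasoning

    groupSize-≤-first : ∀ i → groupSize i ≤ groupSize 0
    groupSize-≤-first i = +-monoʳ-≤ (Π / m) (extra-≤ (Π % m))
      where
      extra-≤ : ∀ r → (if i <ᵇ r then 1 else 0) ≤ (if 0 <ᵇ r then 1 else 0)
      extra-≤ zero = ≤-refl
      extra-≤ (suc r) with i <ᵇ suc r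
      ... | true  = ≤-refl
      ... | false = z≤n

    groupSize-first-≤ : groupSize 0 ≤ Π / m + 1
    groupSize-first-≤ = +-monoʳ-≤ (Π / m) (extra-≤ (Π % m))
      where
      extra-≤ : ∀ r → (if 0 <ᵇ r then 1 else 0) ≤ 1
      extra-≤ zero    = z≤n
      extra-≤ (suc r) = ≤-refl

  module Positions (n : ℕ) {S : Pred ℕ 0ℓ} (S? : Decidable S) where

    opaque
      position : ℕ → ℕ
      position j with j <? count S? n
      ... | yes j<c = proj₁ (select S? n j<c)
      ... | no _    = n

      position-spec : ∀ j → (j < count S? n × position j < n × S (position j) × count S? (position j) ≡ j)
                          ⊎ (count S? n ≤ j × position j ≡ n)
      position-spec j with j <? count S? n
      ... | yes j<c = inj₁ (j<c , proj₂ (select S? n j<c))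
      ... | no j≮c  = inj₂ (≮⇒≥ j≮c , refl)

    position-≤ : ∀ j → position j ≤ n
    position-≤ j with position-spec j
    ... | inj₁ (_ , p<n , _) = <⇒≤ p<n
    ... | inj₂ (_ , p≡n)     = ≤-reflexive p≡n

    position-≥ : ∀ {j} → count S? n ≤ j → position j ≡ n
    position-≥ {j} c≤j with position-spec j
    ... | inj₁ (j<c , _) = contradiction j<c (≤⇒≯ c≤j)
    ... | inj₂ (_ , p≡n) = p≡n

    count-position : ∀ {j} → j ≤ count S? n → count S? (position j) ≡ j
    count-position {j} j≤c with position-spec j
    ... | inj₁ (_ , _ , _ , cp≡j) = cp≡j
    ... | inj₂ (c≤j , p≡n)        = trans (cong (count S?) p≡n) (≤-antisym c≤j j≤c)

    position-mono : ∀ {i j} → i ≤ j → position i ≤ position j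
    position-mono {i} {j} i≤j with position-spec j
    ... | inj₂ (_ , pj≡n) = ≤-trans (position-≤ i) (≤-reflexive (sym pj≡n))
    ... | inj₁ (j<c , _ , sj , cj) with position-spec i
    ...   | inj₂ (c≤i , _) = contradiction (≤-<-trans i≤j j<c) (≤⇒≯ c≤i)
    ...   | inj₁ (_ , _ , _ , ci) with position i ≤? position j
    ...     | yes pi≤pj = pi≤pj
    ...     | no pi≰pj  = contradiction (subst₂ _<_ cj ci (count-strict S? sj (≰⇒> pi≰pj))) (≤⇒≯ i≤j)

    position-+ : ∀ j d → j + d ≤ count S? n → position j + d ≤ position (j + d)
    position-+ j d j+d≤c = begin
      position j + d                      ≤⟨ +-monoʳ-≤ (position j) d≤gap ⟩
      position j + (position (j + d) ∸ position j) ≡⟨ m+[n∸m]≡n p≤p′ ⟩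
      position (j + d)                    ∎
      where
      open ≤-Reasoning
      p≤p′ = position-mono (m≤m+n j d)
      j≤c = ≤-trans (m≤m+n j d) j+d≤c
      d≤gap : d ≤ position (j + d) ∸ position j
      d≤gap = +-cancelˡ-≤ j d _ (begin
        j + d                                               ≡⟨ count-position j+d≤c ⟨
        count S? (position (j + d))                         ≤⟨ count-≤-+∸ S? p≤p′ ⟩
        count S? (position j) + (position (j + d) ∸ position j) ≡⟨ cong (_+ (position (j + d) ∸ position j)) (count-position j≤c) ⟩
        j + (position (j + d) ∸ position j)                 ∎)

module Matching where

  open import Level using (0ℓ)
  open import Data.Nat.Base
  open import Data.Nat.Properties
  open import Data.Fin.Base as Fin using (Fin; toℕ; fromℕ<; punchOut)
  open import Data.Fin.Properties
    using (toℕ<n; toℕ-fromℕ<; toℕ-injective; any?; punchOut-injective; injective⇒≤)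
    renaming (_≟_ to _≟ᶠ_)
  open import Data.Fin.Permutation using (Permutation′; permutation)
  open import Data.Product using (∃-syntax; _×_; _,_; proj₁; proj₂)
  open import Function.Base using (_∘_)
  open import Function.Definitions using (Injective)
  open import Relation.Binary.PropositionalEquality
  open import Relation.Nullary using (Dec; yes; no; ¬_; contradiction)
  open import Relation.Unary using (Pred; Decidable)
  open import Relation.Unary.Properties using (∁?)
  open Counting

  injective⇒surjective : ∀ {n} {f : Fin n → Fin n} → Injective _≡_ _≡_ f → ∀ y → ∃[ x ] f x ≡ y
  injective⇒surjective {suc n} {f} f-injective y with any? (λ x → f x ≟ᶠ y)
  ... | yes hit = hit
  ... | no miss = contradiction (injective⇒≤ punched-injective) (n≮n _)
    where
    y≢f : ∀ x → y ≢ f x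
    y≢f x y≡fx = miss (x , sym y≡fx)
    punched-injective : Injective _≡_ _≡_ (λ x → punchOut (y≢f x))
    punched-injective eq = f-injective (punchOut-injective (y≢f _) (y≢f _) eq)

  injective⇒permutation : ∀ {n} {f : Fin n → Fin n} → Injective _≡_ _≡_ f → Permutation′ n
  injective⇒permutation {f = f} f-injective = permutation f (λ y → proj₁ (surjective y))
    (λ y → proj₂ (surjective y))
    (λ x → f-injective (proj₂ (surjective (f x))))
    where surjective = injective⇒surjective f-injective

  rotate : ℕ → ℕ → ℕ → ℕ
  rotate N s j with s ≤? j
  ... | yes _ = j ∸ s
  ... | no _  = j + (N ∸ s)

  module _ {N s : ℕ} (s≤N : s ≤ N) where

    rotate-≥ : ∀ {j} → s ≤ j → rotate N s j ≡ j ∸ s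
    rotate-≥ {j} s≤j with s ≤? j
    ... | yes _   = refl
    ... | no s≰j = contradiction s≤j s≰j

    rotate-< : ∀ {j} → j < N → rotate N s j < N
    rotate-< {j} j<N with s ≤? j
    ... | yes s≤j = ≤-<-trans (m∸n≤m j s) j<N
    ... | no s≰j  = begin-strict
      j + (N ∸ s)  <⟨ +-monoˡ-< (N ∸ s) (≰⇒> s≰j) ⟩
      s + (N ∸ s)  ≡⟨ m+[n∸m]≡n s≤N ⟩
      N            ∎
      where open ≤-Reasoning

    private
      shifted-down< : ∀ {k} l → s ≤ k → k < N → k ∸ s < l + (N ∸ s)
      shifted-down< l s≤k k<N = <-≤-trans (∸-monoˡ-< k<N s≤k) (m≤n+m (N ∸ s) l)

    rotate-injective : ∀ {i j} → i < N → j < N → rotate N s i ≡ rotate N s j → i ≡ j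
    rotate-injective {i} {j} i<N j<N eq with s ≤? i | s ≤? j
    ... | yes s≤i | yes s≤j = ∸-cancelʳ-≡ s≤i s≤j eq
    ... | no _    | no _    = +-cancelʳ-≡ (N ∸ s) i j eq
    ... | yes s≤i | no _    = contradiction eq (<⇒≢ (shifted-down< j s≤i i<N))
    ... | no _    | yes s≤j = contradiction (sym eq) (<⇒≢ (shifted-down< i s≤j j<N))

  module _ {n : ℕ} {P : Pred ℕ 0ℓ} (P? : Decidable P) where

    elementOfRank : ∀ {j} → j < count P? n → Fin n
    elementOfRank j<c = fromℕ< (proj₁ (proj₂ (select P? n j<c)))

    elementOfRank-spec : ∀ {j} (j<c : j < count P? n) →
                         P (toℕ (elementOfRank j<c)) × count P? (toℕ (elementOfRank j<c)) ≡ j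
    elementOfRank-spec j<c rewrite toℕ-fromℕ< (proj₁ (proj₂ (select P? n j<c))) = proj₂ (proj₂ (select P? n j<c))

    rank< : ∀ (p : Fin n) → P (toℕ p) → count P? (toℕ p) < count P? n
    rank< p Pp = count-strict P? Pp (toℕ<n p)

  module RankMatching {n : ℕ} {A B : Pred ℕ 0ℓ} (A? : Decidable A) (B? : Decidable B)
    (same-count : count A? n ≡ count B? n) (ρ : ℕ → ℕ)
    (ρ-< : ∀ {j} → j < count A? n → ρ j < count B? n)
    (ρ-injective : ∀ {i j} → i < count A? n → j < count A? n → ρ i ≡ ρ j → i ≡ j) where

    same-count-∁ : count (∁? A?) n ≡ count (∁? B?) n
    same-count-∁ = +-cancelʳ-≡ (count A? n) _ _ (begin
      count (∁? A?) n + count A? n    ≡⟨ count-∁ A? n ⟩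
      n                               ≡⟨ count-∁ B? n ⟨
      count (∁? B?) n + count B? n    ≡⟨ cong (count (∁? B?) n +_) same-count ⟨
      count (∁? B?) n + count A? n    ∎)
      where open ≡-Reasoning

    opaque
      match : Fin n → Fin n
      match p with A? (toℕ p)
      ... | yes Ap  = elementOfRank B? (ρ-< (rank< A? p Ap))
      ... | no ¬Ap = elementOfRank (∁? B?) (subst (count (∁? A?) (toℕ p) <_) same-count-∁ (rank< (∁? A?) p ¬Ap))

      match-∈ : ∀ p → A (toℕ p) → B (toℕ (match p)) × count B? (toℕ (match p)) ≡ ρ (count A? (toℕ p))
      match-∈ p Ap with A? (toℕ p)
      ... | yes Ap′ = elementOfRank-spec B? (ρ-< (rank< A? p Ap′))
      ... | no ¬Ap  = contradiction Ap ¬Ap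

      match-∉ : ∀ p → ¬ A (toℕ p) → ¬ B (toℕ (match p)) × count (∁? B?) (toℕ (match p)) ≡ count (∁? A?) (toℕ p)
      match-∉ p ¬Ap with A? (toℕ p)
      ... | yes Ap   = contradiction Ap ¬Ap
      ... | no ¬Ap′ = elementOfRank-spec (∁? B?) (subst (count (∁? A?) (toℕ p) <_) same-count-∁ (rank< (∁? A?) p ¬Ap′))

    match-injective : Injective _≡_ _≡_ match
    match-injective {p} {q} eq = by-cases (A? (toℕ p)) (A? (toℕ q))
      where
      open ≡-Reasoning
      by-cases : Dec (A (toℕ p)) → Dec (A (toℕ q)) → p ≡ q
      by-cases (yes Ap) (yes Aq) = toℕ-injective (count-injective A? Ap Aq
        (ρ-injective (rank< A? p Ap) (rank< A? q Aq) (begin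
          ρ (count A? (toℕ p))        ≡⟨ proj₂ (match-∈ p Ap) ⟨
          count B? (toℕ (match p))    ≡⟨ cong (count B? ∘ toℕ) eq ⟩
          count B? (toℕ (match q))    ≡⟨ proj₂ (match-∈ q Aq) ⟩
          ρ (count A? (toℕ q))        ∎)))
      by-cases (no ¬Ap) (no ¬Aq) = toℕ-injective (count-injective (∁? A?) ¬Ap ¬Aq (begin
          count (∁? A?) (toℕ p)          ≡⟨ proj₂ (match-∉ p ¬Ap) ⟨
          count (∁? B?) (toℕ (match p))  ≡⟨ cong (count (∁? B?) ∘ toℕ) eq ⟩
          count (∁? B?) (toℕ (match q))  ≡⟨ proj₂ (match-∉ q ¬Aq) ⟩
          count (∁? A?) (toℕ q)          ∎))
      by-cases (yes Ap) (no ¬Aq) = contradiction (subst (B ∘ toℕ) eq (proj₁ (match-∈ p Ap))) (proj₁ (match-∉ q ¬Aq))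
      by-cases (no ¬Ap) (yes Aq) = contradiction (subst (B ∘ toℕ) (sym eq) (proj₁ (match-∈ q Aq))) (proj₁ (match-∉ p ¬Ap))

module Rationals where

  open import Data.Nat.Base as ℕ using (ℕ; suc)
  open import Data.Nat.Coprimality using (1-coprimeTo; sym)
  open import Data.Integer.Base as ℤ using (+_; +≤+)
  import Data.Integer.Properties as ℤ
  open import Data.Rational.Base as ℚ using (ℚ; mkℚ; 1ℚ; _/_)
  import Data.Rational.Properties as ℚ
  open import Relation.Binary.PropositionalEquality hiding (sym)
  import Relation.Binary.PropositionalEquality as ≡

  -- Built with mkℚ rather than _/_, so that numerator and denominator of toℚ x compute.
  toℚ : ℕ → ℚ
  toℚ x = mkℚ (+ x) 0 (sym (1-coprimeTo x))

  /1≡toℚ : ∀ x → (+ x) / 1 ≡ toℚ x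
  /1≡toℚ x = ℚ.normalize-coprime (sym (1-coprimeTo x))

  toℚ-+ : ∀ a b → toℚ (a ℕ.+ b) ≡ toℚ a ℚ.+ toℚ b
  toℚ-+ a b = ≡.sym (trans (cong (_/ 1) (cong₂ ℤ._+_ (ℤ.*-identityʳ (+ a)) (ℤ.*-identityʳ (+ b)))) (/1≡toℚ (a ℕ.+ b)))

  toℚ-* : ∀ a b → toℚ (a ℕ.* b) ≡ toℚ a ℚ.* toℚ b
  toℚ-* a b = ≡.sym (trans (cong (_/ 1) (≡.sym (ℤ.pos-* a b))) (/1≡toℚ (a ℕ.* b)))

  toℚ-mono-≤ : ∀ {a b} → a ℕ.≤ b → toℚ a ℚ.≤ toℚ b
  toℚ-mono-≤ {a} {b} a≤b = ℚ.*≤* (subst₂ ℤ._≤_ (≡.sym (ℤ.*-identityʳ (+ a))) (≡.sym (ℤ.*-identityʳ (+ b))) (+≤+ a≤b))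

  toℚ-*-/ : ∀ k .{{_ : ℕ.NonZero k}} → toℚ k ℚ.* ((+ 1) / k) ≡ 1ℚ
  toℚ-*-/ (suc k) = trans (cong (toℚ (suc k) ℚ.*_) (ℚ.normalize-coprime (1-coprimeTo (suc k)))) (ℚ.*-inverseʳ (toℚ (suc k)))

  toℚ-positive : ∀ k .{{_ : ℕ.NonZero k}} → ℚ.Positive (toℚ k)
  toℚ-positive (suc k) = _

  toℚ-≤-/-+1 : ∀ k .{{_ : ℕ.NonZero k}} {x b c} → k ℕ.* x ℕ.≤ b ℕ.+ k → toℚ b ℚ.≤ c →
               toℚ x ℚ.≤ ((+ 1) / k) ℚ.* c ℚ.+ 1ℚ
  toℚ-≤-/-+1 k {x} {b} {c} kx≤b+k b≤c = ℚ.*-cancelˡ-≤-pos (toℚ k) {{toℚ-positive k}} (begin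
    toℚ k ℚ.* toℚ x                                 ≡⟨ toℚ-* k x ⟨
    toℚ (k ℕ.* x)                                   ≤⟨ toℚ-mono-≤ kx≤b+k ⟩
    toℚ (b ℕ.+ k)                                   ≡⟨ toℚ-+ b k ⟩
    toℚ b ℚ.+ toℚ k                                 ≤⟨ ℚ.+-monoˡ-≤ (toℚ k) b≤c ⟩
    c ℚ.+ toℚ k                                     ≡⟨ cong₂ ℚ._+_ (≡.sym (ℚ.*-identityˡ c)) (≡.sym (ℚ.*-identityʳ (toℚ k))) ⟩
    1ℚ ℚ.* c ℚ.+ toℚ k ℚ.* 1ℚ                       ≡⟨ cong (λ u → u ℚ.* c ℚ.+ toℚ k ℚ.* 1ℚ) (toℚ-*-/ k) ⟨
    (toℚ k ℚ.* (+ 1 / k)) ℚ.* c ℚ.+ toℚ k ℚ.* 1ℚ    ≡⟨ cong (ℚ._+ toℚ k ℚ.* 1ℚ) (ℚ.*-assoc (toℚ k) (+ 1 / k) c) ⟩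
    toℚ k ℚ.* (+ 1 / k ℚ.* c) ℚ.+ toℚ k ℚ.* 1ℚ      ≡⟨ ℚ.*-distribˡ-+ (toℚ k) (+ 1 / k ℚ.* c) 1ℚ ⟨
    toℚ k ℚ.* (+ 1 / k ℚ.* c ℚ.+ 1ℚ)                ∎)
    where open ℚ.≤-Reasoning

  p+[q*p+1]≡[1+q]*p+1 : ∀ p q → p ℚ.+ (q ℚ.* p ℚ.+ 1ℚ) ≡ (1ℚ ℚ.+ q) ℚ.* p ℚ.+ 1ℚ
  p+[q*p+1]≡[1+q]*p+1 p q = begin
    p ℚ.+ (q ℚ.* p ℚ.+ 1ℚ)          ≡⟨ ℚ.+-assoc p (q ℚ.* p) 1ℚ ⟨
    p ℚ.+ q ℚ.* p ℚ.+ 1ℚ            ≡⟨ cong (λ u → u ℚ.+ q ℚ.* p ℚ.+ 1ℚ) (ℚ.*-identityˡ p) ⟨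
    1ℚ ℚ.* p ℚ.+ q ℚ.* p ℚ.+ 1ℚ     ≡⟨ cong (ℚ._+ 1ℚ) (ℚ.*-distribʳ-+ p 1ℚ q) ⟨
    (1ℚ ℚ.+ q) ℚ.* p ℚ.+ 1ℚ         ∎
    where open ≡-Reasoning

module Bins where

  open import Defs
  open import Level using (0ℓ)
  open import Data.Bool.Base using (if_then_else_)
  open import Data.Nat.Base as ℕ using (ℕ; zero; suc; z≤n)
  import Data.Nat.Properties as ℕ
  open import Data.Fin.Base as Fin using (Fin; toℕ; _↑ˡ_; _↑ʳ_)
  open import Data.Fin.Properties
    using (suc-injective; toℕ-fromℕ; toℕ-inject₁; splitAt-↑ˡ; splitAt-↑ʳ; splitAt⁻¹-↑ˡ; splitAt⁻¹-↑ʳ)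
    renaming (_≟_ to _≟ᶠ_)
  open import Data.Fin.Permutation using (Permutation′; _⟨$⟩ʳ_)
  open import Data.Rational.Base as ℚ using (ℚ; 0ℚ)
  import Data.Rational.Properties as ℚ
  open import Data.Product using (_×_; proj₁; proj₂)
  open import Data.Sum using (inj₁; inj₂)
  open import Function.Base using (_∘_)
  open import Relation.Binary.PropositionalEquality
  open import Relation.Nullary using (yes; no; does; contradiction)
  open import Relation.Unary using (Pred; Decidable)
  open Counting
  open Rationals

  open import Algebra.Properties.Semiring.Sum ℕ.+-*-semiring
    using (sum; sum-cong-≗; sum-permute; sum-replicate-zero; sum-init-last; ∑-comm; *-distribˡ-sum)
  import Algebra.Properties.CommutativeMonoid.Sum ℚ.+-0-commutativeMonoid as ℚΣ

  sumℚ≡sum : ∀ {n} (g : Fin n → ℚ) → sumℚ g ≡ ℚΣ.sum g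
  sumℚ≡sum {zero}  g = refl
  sumℚ≡sum {suc n} g = cong (g Fin.zero ℚ.+_) (sumℚ≡sum (g ∘ Fin.suc))

  sumℚ-permute : ∀ {n} (g : Fin n → ℚ) (π : Permutation′ n) → sumℚ (g ∘ (π ⟨$⟩ʳ_)) ≡ sumℚ g
  sumℚ-permute g π = begin
    sumℚ (g ∘ (π ⟨$⟩ʳ_))     ≡⟨ sumℚ≡sum (g ∘ (π ⟨$⟩ʳ_)) ⟩
    ℚΣ.sum (g ∘ (π ⟨$⟩ʳ_))   ≡⟨ ℚΣ.sum-permute g π ⟨
    ℚΣ.sum g                 ≡⟨ sumℚ≡sum g ⟨
    sumℚ g                   ∎
    where open ≡-Reasoning

  sumℚ-cong : ∀ {n} {g h : Fin n → ℚ} → (∀ x → g x ≡ h x) → sumℚ g ≡ sumℚ h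
  sumℚ-cong {zero}  _   = refl
  sumℚ-cong {suc n} g≗h = cong₂ ℚ._+_ (g≗h Fin.zero) (sumℚ-cong (g≗h ∘ Fin.suc))

  sumℚ-mono-≤ : ∀ {n} {g h : Fin n → ℚ} → (∀ x → g x ℚ.≤ h x) → sumℚ g ℚ.≤ sumℚ h
  sumℚ-mono-≤ {zero}  _   = ℚ.≤-refl
  sumℚ-mono-≤ {suc n} g≤h = ℚ.+-mono-≤ (g≤h Fin.zero) (sumℚ-mono-≤ (g≤h ∘ Fin.suc))

  sum-mono-≤ : ∀ {n} {g h : Fin n → ℕ} → (∀ x → g x ℕ.≤ h x) → sum g ℕ.≤ sum h
  sum-mono-≤ {zero}  _   = z≤n
  sum-mono-≤ {suc n} g≤h = ℕ.+-mono-≤ (g≤h Fin.zero) (sum-mono-≤ (g≤h ∘ Fin.suc))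

  sumℚ-↑ : ∀ k {n} (h : Fin (k ℕ.+ n) → ℚ) → sumℚ h ≡ sumℚ (h ∘ (_↑ˡ n)) ℚ.+ sumℚ (h ∘ (k ↑ʳ_))
  sumℚ-↑ zero    {n} h = sym (ℚ.+-identityˡ _)
  sumℚ-↑ (suc k) {n} h = trans (cong (h Fin.zero ℚ.+_) (sumℚ-↑ k (h ∘ Fin.suc)))
    (sym (ℚ.+-assoc (h Fin.zero) (sumℚ (h ∘ Fin.suc ∘ (_↑ˡ n))) (sumℚ (h ∘ Fin.suc ∘ (k ↑ʳ_)))))

  indicatorᶠ : ∀ {k} → Fin k → Fin k → ℕ
  indicatorᶠ u j = if does (u ≟ᶠ j) then 1 else 0

  binCount≡sum : ∀ {n k} (a : Fin n → Fin k) j → binCount a j ≡ sum (λ x → indicatorᶠ (a x) j)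
  binCount≡sum {zero}  a j = refl
  binCount≡sum {suc n} a j = cong (indicatorᶠ (a Fin.zero) j ℕ.+_) (binCount≡sum (a ∘ Fin.suc) j)

  binLoad≡sumℚ : ∀ {n k} (sz : Fin n → ℚ) (a : Fin n → Fin k) j →
                 binLoad sz a j ≡ sumℚ (λ x → if does (a x ≟ᶠ j) then sz x else 0ℚ)
  binLoad≡sumℚ {zero}  sz a j = refl
  binLoad≡sumℚ {suc n} sz a j =
    cong ((if does (a Fin.zero ≟ᶠ j) then sz Fin.zero else 0ℚ) ℚ.+_) (binLoad≡sumℚ (sz ∘ Fin.suc) (a ∘ Fin.suc) j)

  module _ {n k : ℕ} (π : Permutation′ n) where

    binCount-permute : (a : Fin n → Fin k) (j : Fin k) → binCount (a ∘ (π ⟨$⟩ʳ_)) j ≡ binCount a j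
    binCount-permute a j = begin
      binCount (a ∘ (π ⟨$⟩ʳ_)) j                       ≡⟨ binCount≡sum (a ∘ (π ⟨$⟩ʳ_)) j ⟩
      sum (λ x → indicatorᶠ (a (π ⟨$⟩ʳ x)) j)           ≡⟨ sum-permute (λ x → indicatorᶠ (a x) j) π ⟨
      sum (λ x → indicatorᶠ (a x) j)                   ≡⟨ binCount≡sum a j ⟨
      binCount a j                                     ∎
      where open ≡-Reasoning

    binLoad-permute : (sz : Fin n → ℚ) (a : Fin n → Fin k) (j : Fin k) →
                      binLoad (sz ∘ (π ⟨$⟩ʳ_)) (a ∘ (π ⟨$⟩ʳ_)) j ≡ binLoad sz a j
    binLoad-permute sz a j = begin
      binLoad (sz ∘ (π ⟨$⟩ʳ_)) (a ∘ (π ⟨$⟩ʳ_)) j        ≡⟨ binLoad≡sumℚ (sz ∘ (π ⟨$⟩ʳ_)) (a ∘ (π ⟨$⟩ʳ_)) j ⟩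
      sumℚ (member ∘ (π ⟨$⟩ʳ_))                         ≡⟨ sumℚ-permute member π ⟩
      sumℚ member                                      ≡⟨ binLoad≡sumℚ sz a j ⟨
      binLoad sz a j                                   ∎
      where
      open ≡-Reasoning
      member : Fin n → ℚ
      member x = if does (a x ≟ᶠ j) then sz x else 0ℚ

  module _ {k k′ : ℕ} where

    binCount-≤ : ∀ {n} (a : Fin n → Fin k) (b : Fin n → Fin k′) {j j′} →
                 (∀ x → a x ≡ j → b x ≡ j′) → binCount a j ℕ.≤ binCount b j′
    binCount-≤ {zero}  a b         _      = z≤n
    binCount-≤ {suc n} a b {j} {j′} a⇒b = ℕ.+-mono-≤ (head (a Fin.zero ≟ᶠ j) (b Fin.zero ≟ᶠ j′))
      (binCount-≤ (a ∘ Fin.suc) (b ∘ Fin.suc) (a⇒b ∘ Fin.suc))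
      where
      head : ∀ a? b? → (if does a? then 1 else 0) ℕ.≤ (if does b? then 1 else 0)
      head (yes _)   (yes _)  = ℕ.≤-refl
      head (yes a≡j) (no b≢j) = contradiction (a⇒b Fin.zero a≡j) b≢j
      head (no _)    _        = z≤n

    binLoad-≤ : ∀ {n} (r s : Fin n → ℚ) (a : Fin n → Fin k) (b : Fin n → Fin k′) {j j′} →
                (∀ x → a x ≡ j → b x ≡ j′ × r x ℚ.≤ s x) → (∀ x → 0ℚ ℚ.≤ s x) →
                binLoad r a j ℚ.≤ binLoad s b j′
    binLoad-≤ {zero}  r s a b         _   _   = ℚ.≤-refl
    binLoad-≤ {suc n} r s a b {j} {j′} a⇒b s≥0 = ℚ.+-mono-≤ (head (a Fin.zero ≟ᶠ j) (b Fin.zero ≟ᶠ j′))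
      (binLoad-≤ (r ∘ Fin.suc) (s ∘ Fin.suc) (a ∘ Fin.suc) (b ∘ Fin.suc) (a⇒b ∘ Fin.suc) (s≥0 ∘ Fin.suc))
      where
      head : ∀ a? b? → (if does a? then r Fin.zero else 0ℚ) ℚ.≤ (if does b? then s Fin.zero else 0ℚ)
      head (yes a≡j) (yes _)  = proj₂ (a⇒b Fin.zero a≡j)
      head (yes a≡j) (no b≢j) = contradiction (proj₁ (a⇒b Fin.zero a≡j)) b≢j
      head (no _)    (yes _)  = s≥0 Fin.zero
      head (no _)    (no _)   = ℚ.≤-refl

  binCount-≤-n : ∀ {n k} (a : Fin n → Fin k) j → binCount a j ℕ.≤ n
  binCount-≤-n {zero}  a j = z≤n
  binCount-≤-n {suc n} a j = ℕ.+-mono-≤ (head (a Fin.zero ≟ᶠ j)) (binCount-≤-n (a ∘ Fin.suc) j)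
    where
    head : ∀ a? → (if does a? then 1 else 0) ℕ.≤ 1
    head (yes _) = ℕ.≤-refl
    head (no _)  = z≤n

  module _ {k : ℕ} where

    binCount-empty : ∀ {n} (a : Fin n → Fin k) {j} → (∀ x → a x ≢ j) → binCount a j ≡ 0
    binCount-empty {zero}  a     _     = refl
    binCount-empty {suc n} a {j} empty with a Fin.zero ≟ᶠ j
    ... | yes a≡j = contradiction a≡j (empty Fin.zero)
    ... | no _    = binCount-empty (a ∘ Fin.suc) (empty ∘ Fin.suc)

    binLoad-empty : ∀ {n} (r : Fin n → ℚ) (a : Fin n → Fin k) {j} → (∀ x → a x ≢ j) → binLoad r a j ≡ 0ℚ
    binLoad-empty {zero}  r a     _     = refl
    binLoad-empty {suc n} r a {j} empty with a Fin.zero ≟ᶠ j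
    ... | yes a≡j = contradiction a≡j (empty Fin.zero)
    ... | no _    = trans (ℚ.+-identityˡ _) (binLoad-empty (r ∘ Fin.suc) (a ∘ Fin.suc) (empty ∘ Fin.suc))

    private
      others-elsewhere : ∀ {n} (a : Fin (suc n) → Fin k) {j} → (∀ x → a x ≡ j → x ≡ Fin.zero) →
                         ∀ x → a (Fin.suc x) ≢ j
      others-elsewhere a only x a≡j with only (Fin.suc x) a≡j
      ... | ()

      first-elsewhere : ∀ {n} (a : Fin (suc n) → Fin k) {j p} → (∀ x → a x ≡ j → x ≡ Fin.suc p) → a Fin.zero ≢ j
      first-elsewhere a only a≡j with only Fin.zero a≡j
      ... | ()

    binCount-singleton : ∀ {n} (a : Fin n → Fin k) {j} p → (∀ x → a x ≡ j → x ≡ p) → binCount a j ℕ.≤ 1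
    binCount-singleton {suc n} a {j} Fin.zero only with a Fin.zero ≟ᶠ j
    ... | yes _ = ℕ.≤-reflexive (cong suc (binCount-empty (a ∘ Fin.suc) (others-elsewhere a only)))
    ... | no _  = ℕ.≤-trans (ℕ.≤-reflexive (binCount-empty (a ∘ Fin.suc) (others-elsewhere a only))) z≤n
    binCount-singleton {suc n} a {j} (Fin.suc p) only with a Fin.zero ≟ᶠ j
    ... | yes a≡j = contradiction a≡j (first-elsewhere a only)
    ... | no _    = binCount-singleton (a ∘ Fin.suc) p (λ x a≡j → suc-injective (only (Fin.suc x) a≡j))

    binLoad-singleton : ∀ {n} (r : Fin n → ℚ) (a : Fin n → Fin k) {j} p → 0ℚ ℚ.≤ r p →
                        (∀ x → a x ≡ j → x ≡ p) → binLoad r a j ℚ.≤ r p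
    binLoad-singleton {suc n} r a {j} Fin.zero r≥0 only
      rewrite binLoad-empty (r ∘ Fin.suc) (a ∘ Fin.suc) (others-elsewhere a only) with a Fin.zero ≟ᶠ j
    ... | yes _ = ℚ.≤-reflexive (ℚ.+-identityʳ _)
    ... | no _  = r≥0
    binLoad-singleton {suc n} r a {j} (Fin.suc p) r≥0 only with a Fin.zero ≟ᶠ j
    ... | yes a≡j = contradiction a≡j (first-elsewhere a only)
    ... | no _    = ℚ.≤-trans (ℚ.≤-reflexive (ℚ.+-identityˡ _))
                      (binLoad-singleton (r ∘ Fin.suc) (a ∘ Fin.suc) p r≥0 (λ x a≡j → suc-injective (only (Fin.suc x) a≡j)))

  sum-indicatorᶠ : ∀ {k} (h : Fin k → ℕ) u → sum (λ j → h j ℕ.* indicatorᶠ u j) ≡ h u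
  sum-indicatorᶠ {suc k} h Fin.zero = begin
    h Fin.zero ℕ.* 1 ℕ.+ sum (λ j → h (Fin.suc j) ℕ.* 0)
      ≡⟨ cong₂ ℕ._+_ (ℕ.*-identityʳ _) (sum-cong-≗ (ℕ.*-zeroʳ ∘ h ∘ Fin.suc)) ⟩
    h Fin.zero ℕ.+ sum {k} (λ _ → 0)                       ≡⟨ cong (h Fin.zero ℕ.+_) (sum-replicate-zero k) ⟩
    h Fin.zero ℕ.+ 0                                       ≡⟨ ℕ.+-identityʳ _ ⟩
    h Fin.zero                                             ∎
    where open ≡-Reasoning
  sum-indicatorᶠ {suc k} h (Fin.suc u) =
    trans (cong (ℕ._+ sum (λ j → h (Fin.suc j) ℕ.* indicatorᶠ u j)) (ℕ.*-zeroʳ (h Fin.zero))) (sum-indicatorᶠ (h ∘ Fin.suc) u)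

  sum-binCount : ∀ {n k} (a : Fin n → Fin k) (h : Fin k → ℕ) → sum (h ∘ a) ≡ sum (λ j → h j ℕ.* binCount a j)
  sum-binCount a h = begin
    sum (h ∘ a)                                                ≡⟨ sum-cong-≗ (λ x → sym (sum-indicatorᶠ h (a x))) ⟩
    sum (λ x → sum (λ j → h j ℕ.* indicatorᶠ (a x) j))          ≡⟨ ∑-comm (λ x j → h j ℕ.* indicatorᶠ (a x) j) ⟩
    sum (λ j → sum (λ x → h j ℕ.* indicatorᶠ (a x) j))
      ≡⟨ sum-cong-≗ (λ j → sym (*-distribˡ-sum (h j) (λ x → indicatorᶠ (a x) j))) ⟩
    sum (λ j → h j ℕ.* sum (λ x → indicatorᶠ (a x) j))          ≡⟨ sum-cong-≗ (λ j → cong (h j ℕ.*_) (binCount≡sum a j)) ⟨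
    sum (λ j → h j ℕ.* binCount a j)                            ∎
    where open ≡-Reasoning

  count≡sum : ∀ {P : Pred ℕ 0ℓ} (P? : Decidable P) n → count P? n ≡ sum (λ (p : Fin n) → indicator (P? (toℕ p)))
  count≡sum P? zero    = refl
  count≡sum P? (suc n) = begin
    indicator (P? n) ℕ.+ count P? n                         ≡⟨ ℕ.+-comm _ (count P? n) ⟩
    count P? n ℕ.+ indicator (P? n)                         ≡⟨ cong₂ ℕ._+_ (count≡sum P? n) (cong at (sym (toℕ-fromℕ n))) ⟩
    sum {n} (at ∘ toℕ) ℕ.+ at (toℕ (Fin.fromℕ n))           ≡⟨ cong (ℕ._+ at (toℕ (Fin.fromℕ n))) (sum-cong-≗ {n} (cong at ∘ sym ∘ toℕ-inject₁)) ⟩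
    sum {n} (at ∘ toℕ ∘ Fin.inject₁) ℕ.+ at (toℕ (Fin.fromℕ n)) ≡⟨ sum-init-last {n} (at ∘ toℕ) ⟨
    sum {suc n} (at ∘ toℕ)                                  ∎
    where
    open ≡-Reasoning
    at : ℕ → ℕ
    at x = indicator (P? x)

  binCount-cong : ∀ {n k} {a b : Fin n → Fin k} → (∀ x → a x ≡ b x) → ∀ j → binCount a j ≡ binCount b j
  binCount-cong {a = a} {b} a≗b j = begin
    binCount a j                      ≡⟨ binCount≡sum a j ⟩
    sum (λ x → indicatorᶠ (a x) j)    ≡⟨ sum-cong-≗ (λ x → cong (λ u → indicatorᶠ u j) (a≗b x)) ⟩
    sum (λ x → indicatorᶠ (b x) j)    ≡⟨ binCount≡sum b j ⟨
    binCount b j                      ∎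
    where open ≡-Reasoning

  binLoad-cong : ∀ {n k} {r r′ : Fin n → ℚ} {a a′ : Fin n → Fin k} →
                 (∀ x → r x ≡ r′ x) → (∀ x → a x ≡ a′ x) → ∀ j → binLoad r a j ≡ binLoad r′ a′ j
  binLoad-cong {zero}  r≗r′ a≗a′ j = refl
  binLoad-cong {suc n} r≗r′ a≗a′ j =
    cong₂ ℚ._+_ (cong₂ (λ u v → if does (v ≟ᶠ j) then u else 0ℚ) (r≗r′ Fin.zero) (a≗a′ Fin.zero))
                (binLoad-cong (r≗r′ ∘ Fin.suc) (a≗a′ ∘ Fin.suc) j)

  sumℚ-toℚ : ∀ {n} (g : Fin n → ℕ) → sumℚ (toℚ ∘ g) ≡ toℚ (sum g)
  sumℚ-toℚ {zero}  g = refl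
  sumℚ-toℚ {suc n} g =
    trans (cong (toℚ (g Fin.zero) ℚ.+_) (sumℚ-toℚ (g ∘ Fin.suc))) (sym (toℚ-+ (g Fin.zero) (sum (g ∘ Fin.suc))))

  data SplitLabel {k n : ℕ} : Fin (k ℕ.+ n) → Set where
    left  : ∀ j → SplitLabel (j ↑ˡ n)
    right : ∀ q → SplitLabel (k ↑ʳ q)

  splitLabel : ∀ {k n} (j : Fin (k ℕ.+ n)) → SplitLabel j
  splitLabel {k} j with Fin.splitAt k j in eq
  ... | inj₁ j′ = subst SplitLabel (splitAt⁻¹-↑ˡ eq) (left j′)
  ... | inj₂ q  = subst SplitLabel (splitAt⁻¹-↑ʳ eq) (right q)

  ↑ˡ≢↑ʳ : ∀ {k n} (j : Fin k) (q : Fin n) → j ↑ˡ n ≢ k ↑ʳ q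
  ↑ˡ≢↑ʳ {k} {n} j q eq with trans (sym (splitAt-↑ˡ k j n)) (trans (cong (Fin.splitAt k) eq) (splitAt-↑ʳ k n q))
  ... | ()

module Regrouping where

  open import Level using (0ℓ)
  open import Data.Nat.Base
  open import Data.Nat.Properties
  open import Data.Fin.Base as Fin using (Fin; toℕ)
  open import Data.Fin.Properties using (toℕ<n)
  open import Data.Fin.Permutation using (Permutation′)
  open import Data.Product using (_,_; proj₁; proj₂)
  open import Relation.Binary.PropositionalEquality
  open import Relation.Nullary using (¬_)
  open import Relation.Unary using (Pred; Decidable)
  open import Relation.Unary.Properties using (∁?)
  open Counting
  open Blocks
  open Breakpoints
  open Matching

  module SparseRegrouping (m : ℕ) .{{_ : NonZero m}} (n : ℕ) {S : Pred ℕ 0ℓ} (S? : Decidable S) where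

    Π : ℕ
    Π = count S? n

    open GroupSizes m Π public
    open Positions n S?

    offset : ℕ → ℕ
    offset = prefixSum groupSize

    t : ℕ → ℕ
    t i = position (offset i)

    offset≤Π : ∀ {i} → i ≤ m → offset i ≤ Π
    offset≤Π i≤m = ≤-trans (prefixSum-mono groupSize i≤m) (≤-reflexive prefixSum-groupSize-m)

    count-t : ∀ {i} → i ≤ m → count S? (t i) ≡ offset i
    count-t i≤m = count-position (offset≤Π i≤m)

    t-ordered : ∀ {i} → i < m → t i + groupSize i ≤ t (suc i)
    t-ordered {i} i<m = position-+ (offset i) (groupSize i) (offset≤Π i<m)

    t-last : t m ≡ n
    t-last = position-≥ (≤-reflexive (sym prefixSum-groupSize-m))

    open OrderedBlocks m t groupSize t-ordered public

    Ψ : Pred ℕ 0ℓ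
    Ψ = InBlocks m

    Ψ? : Decidable Ψ
    Ψ? = inBlocks? m

    Ψ₀ : Pred ℕ 0ℓ
    Ψ₀ = InBlock (t 0) (groupSize 0)

    Ψ₀? : Decidable Ψ₀
    Ψ₀? = inBlock? (t 0) (groupSize 0)

    Ψ₀⇒Ψ : ∀ {x} → Ψ₀ x → Ψ x
    Ψ₀⇒Ψ x∈Ψ₀ = 0 , >-nonZero⁻¹ m , x∈Ψ₀

    count-Ψ : count Ψ? n ≡ Π
    count-Ψ = trans (count-inBlocks-complete ≤-refl (≤-reflexive t-last)) prefixSum-groupSize-m

    count-Ψ₀ : count Ψ₀? n ≤ groupSize 0
    count-Ψ₀ = ≤-trans (≤-reflexive (count-inBlock (t 0) (groupSize 0) n)) (m⊓n≤n _ _)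

    S-dominated : ∀ {y} → y ≤ n → count S? y ≤ count Ψ? y
    S-dominated y≤n = count-dominated S? count-t ≤-refl (≤-trans y≤n (≤-reflexive (sym t-last)))

    first≤Π : groupSize 0 ≤ Π
    first≤Π = offset≤Π (>-nonZero⁻¹ m)

    private
      below-Π : ∀ {j} → j < count Ψ? n → j < Π
      below-Π = subst (_ <_) count-Ψ

      rotate-<Π : ∀ {j} → j < count Ψ? n → rotate Π (groupSize 0) j < Π
      rotate-<Π j<c = rotate-< first≤Π (below-Π j<c)

      rotate-injectiveΠ : ∀ {i j} → i < count Ψ? n → j < count Ψ? n →
                          rotate Π (groupSize 0) i ≡ rotate Π (groupSize 0) j → i ≡ j
      rotate-injectiveΠ i<c j<c = rotate-injective first≤Π (below-Π i<c) (below-Π j<c)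

      module R = RankMatching {n} Ψ? S? count-Ψ (rotate Π (groupSize 0)) rotate-<Π rotate-injectiveΠ

    open R public using (match; match-injective)

    match-permutation : Permutation′ n
    match-permutation = injective⇒permutation match-injective

    match-∈Ψ : ∀ p → Ψ (toℕ p) → S (toℕ (match p))
    match-∈Ψ p p∈Ψ = proj₁ (R.match-∈ p p∈Ψ)

    match-∉Ψ : ∀ p → ¬ Ψ (toℕ p) → ¬ S (toℕ (match p))
    match-∉Ψ p p∉Ψ = proj₁ (R.match-∉ p p∉Ψ)

    match-∉Ψ-≤ : ∀ p → ¬ Ψ (toℕ p) → toℕ (match p) ≤ toℕ p
    match-∉Ψ-≤ p p∉Ψ = s≤s⁻¹ (count-<⇒< (∁? S?) (begin-strict
      count (∁? S?) (toℕ (match p))   ≡⟨ proj₂ (R.match-∉ p p∉Ψ) ⟩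
      count (∁? Ψ?) (toℕ p)           <⟨ ≤-reflexive (sym (count-yes (∁? Ψ?) p∉Ψ)) ⟩
      count (∁? Ψ?) (suc (toℕ p))     ≤⟨ count-∁-antitone S? Ψ? (S-dominated (toℕ<n p)) ⟩
      count (∁? S?) (suc (toℕ p))     ∎))
      where open ≤-Reasoning

    match-later-block-< : ∀ {i} p → 0 < i → i < m → InBlock (t i) (groupSize i) (toℕ p) → toℕ (match p) < t i
    match-later-block-< {i} p 0<i i<m p∈Γ@(t≤p , p<end) = count-<⇒< S? (begin-strict
      count S? (toℕ (match p))                       ≡⟨ proj₂ (R.match-∈ p (i , i<m , p∈Γ)) ⟩
      rotate Π (groupSize 0) rank                     ≡⟨ rotate-≥ first≤Π first≤rank ⟩
      rank ∸ groupSize 0                              <⟨ ∸-monoˡ-< rank<end first≤rank ⟩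
      (offset i + groupSize 0) ∸ groupSize 0          ≡⟨ m+n∸n≡m (offset i) (groupSize 0) ⟩
      offset i                                        ≡⟨ count-t (<⇒≤ i<m) ⟨
      count S? (t i)                                  ∎)
      where
      open ≤-Reasoning
      rank = count Ψ? (toℕ p)
      rank≡ : rank ≡ offset i + (toℕ p ∸ t i)
      rank≡ = count-inBlocks-inside i<m p∈Γ
      first≤rank : groupSize 0 ≤ rank
      first≤rank = ≤-trans (prefixSum-mono groupSize 0<i) (≤-trans (m≤m+n _ _) (≤-reflexive (sym rank≡)))
      p∸t<π : toℕ p ∸ t i < groupSize i
      p∸t<π = subst (toℕ p ∸ t i <_) (m+n∸m≡n (t i) (groupSize i)) (∸-monoˡ-< p<end t≤p)
      rank<end : rank < offset i + groupSize 0
      rank<end = subst (_< offset i + groupSize 0) (sym rank≡) (+-monoʳ-< (offset i) (≤-trans p∸t<π (groupSize-≤-first i)))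

open import Defs
open import Level using (0ℓ)
open import Data.Nat.Base as ℕ using (ℕ; zero; suc; NonZero; z≤n; s≤s)
import Data.Nat.Properties as ℕ
open import Algebra.Properties.Semiring.Sum ℕ.+-*-semiring using (sum; sum-cong-≗; sum-permute; *-distribˡ-sum)
open import Data.Nat.DivMod using (_/_; m/n*n≤m)
open import Data.Integer.Base using (+_)
open import Data.Fin.Base as Fin using (Fin; toℕ; fromℕ<; _↑ˡ_; _↑ʳ_)
open import Data.Fin.Properties
  using (toℕ<n; toℕ-fromℕ<; toℕ-fromℕ; toℕ-inject₁; toℕ-injective; any?; ↑ˡ-injective; ↑ʳ-injective)
open import Data.Fin.Permutation using (Permutation′; _⟨$⟩ˡ_; _∘ₚ_; inverseˡ)
open import Data.Rational.Base as ℚ using (ℚ; 0ℚ; 1ℚ)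
import Data.Rational.Properties as ℚ
open import Data.Product using (∃-syntax; Σ; _×_; _,_; proj₁; proj₂)
open import Data.Sum using (inj₁; inj₂)
open import Function.Base using (_∘_)
open import Relation.Binary.PropositionalEquality
open import Relation.Nullary using (Dec; yes; no; ¬_; contradiction; _×-dec_)
open import Relation.Unary using (Pred; Decidable)
open Counting
open Blocks
open Matching
open Rationals
open Bins
open Regrouping

module _ {n} {s : Fin n → ℚ} {σ : Fin n → Fin n} (sorted : SortedOrder s σ) where

  sortedOrder-permutation : Permutation′ n
  sortedOrder-permutation = injective⇒permutation (λ {p} {q} → proj₁ sorted p q)

  sortedOrder-antitone : ∀ {p q} → toℕ p ℕ.≤ toℕ q → s (σ q) ℚ.≤ s (σ p)
  sortedOrder-antitone {p} {q} p≤q with toℕ p ℕ.<? toℕ q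
  ... | yes p<q with proj₂ sorted p q p<q
  ...   | inj₁ smaller     = ℚ.<⇒≤ smaller
  ...   | inj₂ (equal , _) = ℚ.≤-reflexive (sym equal)
  sortedOrder-antitone {p} {q} p≤q | no p≮q
    rewrite toℕ-injective {i = p} {j = q} (ℕ.≤-antisym p≤q (ℕ.≮⇒≥ p≮q)) = ℚ.≤-refl

module Construction (k : ℕ) .{{_ : NonZero k}} (n : ℕ) (s : Fin n → ℚ)
  (s-bounds : ∀ i → (0ℚ ℚ.≤ s i) × (s i ℚ.≤ 1ℚ))
  (σ : Fin n → Fin n) (sorted : SortedOrder s σ) (kO : ℕ) (O : Fin n → Fin kO) where

  instance
    k²-nonZero : NonZero (k ℕ.* k)
    k²-nonZero = ℕ.m*n≢0 k k
    k³-nonZero : NonZero (cube k)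
    k³-nonZero = ℕ.m*n≢0 (k ℕ.* k) k

  SparseBin : Pred (Fin kO) 0ℓ
  SparseBin j = binCount O j ℕ.≤ k ℕ.* k

  sparseBin? : Decidable SparseBin
  sparseBin? j = binCount O j ℕ.≤? k ℕ.* k

  SparseAt : Pred ℕ 0ℓ
  SparseAt x = ∃[ p ] toℕ p ≡ x × SparseBin (O (σ p))

  sparseAt? : Decidable SparseAt
  sparseAt? x = any? (λ p → (toℕ p ℕ.≟ x) ×-dec sparseBin? (O (σ p)))

  sparseAt⁺ : ∀ p → SparseBin (O (σ p)) → SparseAt (toℕ p)
  sparseAt⁺ p sparse = p , refl , sparse

  sparseAt⁻ : ∀ p → SparseAt (toℕ p) → SparseBin (O (σ p))
  sparseAt⁻ p (q , q≡p , sparse) = subst (SparseBin ∘ O ∘ σ) (toℕ-injective q≡p) sparse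

  open SparseRegrouping (cube k) n sparseAt? public

  breakpoints : Fin (suc (cube k)) → ℕ
  breakpoints i = t (toℕ i)

  breakpoints-last : breakpoints (Fin.fromℕ (cube k)) ≡ n
  breakpoints-last = trans (cong t (toℕ-fromℕ (cube k))) t-last

  -- piSize k Π i unfolds to groupSize (toℕ i).
  breakpoints-ordered : ∀ i → breakpoints (Fin.inject₁ i) ℕ.+ piSize k Π i ℕ.≤ breakpoints (Fin.suc i)
  breakpoints-ordered i rewrite toℕ-inject₁ i = t-ordered (toℕ<n i)

  breakpoints-mono : ∀ i → breakpoints (Fin.inject₁ i) ℕ.≤ breakpoints (Fin.suc i)
  breakpoints-mono i = ℕ.≤-trans (ℕ.m≤m+n _ _) (breakpoints-ordered i)

  private
    toℕ-inject₁-fromℕ< : ∀ {i} (i<m : i ℕ.< cube k) → toℕ (Fin.inject₁ (fromℕ< i<m)) ≡ i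
    toℕ-inject₁-fromℕ< i<m = trans (toℕ-inject₁ (fromℕ< i<m)) (toℕ-fromℕ< i<m)

    inBlock-fromℕ< : ∀ {i x} (i<m : i ℕ.< cube k) → InBlock (t i) (groupSize i) x →
                     InBlock (breakpoints (Fin.inject₁ (fromℕ< i<m))) (groupSize (toℕ (fromℕ< i<m))) x
    inBlock-fromℕ< {x = x} i<m = subst₂ (λ a b → InBlock (t a) (groupSize b) x)
      (sym (toℕ-inject₁-fromℕ< i<m)) (sym (toℕ-fromℕ< i<m))

  InΨ⇒Ψ : ∀ {x} → InΨ k Π breakpoints x → Ψ x
  InΨ⇒Ψ {x} (i , x∈Γ) = toℕ i , toℕ<n i , subst (λ a → InBlock (t a) (groupSize (toℕ i)) x) (toℕ-inject₁ i) x∈Γ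

  Ψ⇒InΨ : ∀ {x} → Ψ x → InΨ k Π breakpoints x
  Ψ⇒InΨ (i , i<m , x∈Γ) = fromℕ< i<m , inBlock-fromℕ< i<m x∈Γ

  matchedBin : Fin n → Fin kO
  matchedBin p = O (σ (match p))

  -- Labels j ↑ˡ n are the bins of O, labels kO ↑ʳ p are fresh singleton bins.
  -- Position p gets a fresh bin if it lies in Ψ₀ and joins the bin of its partner otherwise.
  positionBinWith : ∀ p → Dec (Ψ₀ (toℕ p)) → Fin (kO ℕ.+ n)
  positionBinWith p (yes _) = kO ↑ʳ p
  positionBinWith p (no _)  = matchedBin p ↑ˡ n

  positionBin : Fin n → Fin (kO ℕ.+ n)
  positionBin p = positionBinWith p (Ψ₀? (toℕ p))

  positionBin-∈Ψ₀ : ∀ p → Ψ₀ (toℕ p) → positionBin p ≡ kO ↑ʳ p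
  positionBin-∈Ψ₀ p p∈Ψ₀ = go (Ψ₀? (toℕ p))
    where
    go : ∀ d → positionBinWith p d ≡ kO ↑ʳ p
    go (yes _)    = refl
    go (no p∉Ψ₀) = contradiction p∈Ψ₀ p∉Ψ₀

  positionBin-∉Ψ₀ : ∀ p → ¬ Ψ₀ (toℕ p) → positionBin p ≡ matchedBin p ↑ˡ n
  positionBin-∉Ψ₀ p p∉Ψ₀ = go (Ψ₀? (toℕ p))
    where
    go : ∀ d → positionBinWith p d ≡ matchedBin p ↑ˡ n
    go (yes p∈Ψ₀) = contradiction p∈Ψ₀ p∉Ψ₀
    go (no _)     = refl

  in-old-bin : ∀ {p j} → positionBin p ≡ j ↑ˡ n → ¬ Ψ₀ (toℕ p) × matchedBin p ≡ j
  in-old-bin {p} {j} = go (Ψ₀? (toℕ p))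
    where
    go : ∀ d → positionBinWith p d ≡ j ↑ˡ n → ¬ Ψ₀ (toℕ p) × matchedBin p ≡ j
    go (yes _)    eq = contradiction (sym eq) (↑ˡ≢↑ʳ j p)
    go (no p∉Ψ₀) eq = p∉Ψ₀ , ↑ˡ-injective n _ _ eq

  in-fresh-bin : ∀ {p q} → positionBin p ≡ kO ↑ʳ q → p ≡ q × Ψ₀ (toℕ q)
  in-fresh-bin {p} {q} = go (Ψ₀? (toℕ p))
    where
    go : ∀ d → positionBinWith p d ≡ kO ↑ʳ q → p ≡ q × Ψ₀ (toℕ q)
    go (yes p∈Ψ₀) eq = let p≡q = ↑ʳ-injective kO p q eq in p≡q , subst (Ψ₀ ∘ toℕ) p≡q p∈Ψ₀
    go (no _)     eq = contradiction eq (↑ˡ≢↑ʳ _ q)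

  σ-perm : Permutation′ n
  σ-perm = sortedOrder-permutation {s = s} sorted

  matched-permutation : Permutation′ n
  matched-permutation = match-permutation ∘ₚ σ-perm

  matchedBin-sparse : ∀ p → Ψ (toℕ p) → SparseBin (matchedBin p)
  matchedBin-sparse p p∈Ψ = sparseAt⁻ (match p) (match-∈Ψ p p∈Ψ)

  matchedBin-dense : ∀ p → ¬ Ψ (toℕ p) → ¬ SparseBin (matchedBin p)
  matchedBin-dense p p∉Ψ sparse = match-∉Ψ p p∉Ψ (sparseAt⁺ (match p) sparse)

  matchedBin-sparse⁻ : ∀ p → SparseBin (matchedBin p) → Ψ (toℕ p)
  matchedBin-sparse⁻ p sparse = go (Ψ? (toℕ p))
    where
    go : Dec (Ψ (toℕ p)) → Ψ (toℕ p)
    go (yes p∈Ψ) = p∈Ψ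
    go (no p∉Ψ)  = contradiction sparse (matchedBin-dense p p∉Ψ)

  binCount-old-≤ : ∀ j → binCount positionBin (j ↑ˡ n) ℕ.≤ binCount O j
  binCount-old-≤ j = ℕ.≤-trans (binCount-≤ positionBin matchedBin (λ p eq → proj₂ (in-old-bin eq)))
                               (ℕ.≤-reflexive (binCount-permute matched-permutation O j))

  binCount-old-dense : ∀ {j} → ¬ SparseBin j → binCount positionBin (j ↑ˡ n) ≡ binCount O j
  binCount-old-dense {j} dense = ℕ.≤-antisym (binCount-old-≤ j) (ℕ.≤-trans
    (ℕ.≤-reflexive (sym (binCount-permute matched-permutation O j)))
    (binCount-≤ matchedBin positionBin (λ p eq → trans (positionBin-∉Ψ₀ p (p∉Ψ₀ p eq)) (cong (_↑ˡ n) eq))))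
    where
    p∉Ψ₀ : ∀ p → matchedBin p ≡ j → ¬ Ψ₀ (toℕ p)
    p∉Ψ₀ p eq p∈Ψ₀ = dense (subst SparseBin eq (matchedBin-sparse p (Ψ₀⇒Ψ p∈Ψ₀)))

  sparse-positionBin : ∀ {j} p → positionBin p ≡ j → Ψ (toℕ p) →
                       (∀ q → positionBin q ≡ j → Ψ (toℕ q)) × (binCount positionBin j ℕ.≤ k ℕ.* k)
  sparse-positionBin {j} p p↦j p∈Ψ = go (Ψ₀? (toℕ p))
    where
    go : Dec (Ψ₀ (toℕ p)) → (∀ q → positionBin q ≡ j → Ψ (toℕ q)) × (binCount positionBin j ℕ.≤ k ℕ.* k)
    go (yes p∈Ψ₀) = (λ q q↦j → subst (Ψ ∘ toℕ) (sym (only-p q q↦j)) p∈Ψ) ,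
                    ℕ.≤-trans (binCount-singleton positionBin p only-p) (ℕ.>-nonZero⁻¹ (k ℕ.* k))
      where
      only-p : ∀ q → positionBin q ≡ j → q ≡ p
      only-p q q↦j = proj₁ (in-fresh-bin (trans q↦j (trans (sym p↦j) (positionBin-∈Ψ₀ p p∈Ψ₀))))
    go (no p∉Ψ₀) = (λ q q↦j → matchedBin-sparse⁻ q (subst SparseBin (sym (same-bin q q↦j)) sparse)) ,
                   subst (λ j → binCount positionBin j ℕ.≤ k ℕ.* k) j≡ (ℕ.≤-trans (binCount-old-≤ (matchedBin p)) sparse)
      where
      j≡ : matchedBin p ↑ˡ n ≡ j
      j≡ = trans (sym (positionBin-∉Ψ₀ p p∉Ψ₀)) p↦j
      sparse = matchedBin-sparse p p∈Ψ
      same-bin : ∀ q → positionBin q ≡ j → matchedBin q ≡ matchedBin p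
      same-bin q q↦j = proj₂ (in-old-bin (trans q↦j (sym j≡)))

  dense-positionBin : ∀ {j} p → positionBin p ≡ j → ¬ Ψ (toℕ p) →
                      (∀ q → positionBin q ≡ j → ¬ Ψ (toℕ q)) × (k ℕ.* k ℕ.< binCount positionBin j)
  dense-positionBin {j} p p↦j p∉Ψ =
    (λ q q↦j q∈Ψ → dense (subst SparseBin (same-bin q q↦j) (matchedBin-sparse q q∈Ψ))) ,
    subst (λ j → k ℕ.* k ℕ.< binCount positionBin j) j≡
      (ℕ.<-≤-trans (ℕ.≰⇒> dense) (ℕ.≤-reflexive (sym (binCount-old-dense dense))))
    where
    dense = matchedBin-dense p p∉Ψ
    j≡ : matchedBin p ↑ˡ n ≡ j
    j≡ = trans (sym (positionBin-∉Ψ₀ p (p∉Ψ ∘ Ψ₀⇒Ψ))) p↦j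
    same-bin : ∀ q → positionBin q ≡ j → matchedBin q ≡ matchedBin p
    same-bin q q↦j = proj₂ (in-old-bin (trans q↦j (sym j≡)))

  packing : Fin n → Fin (kO ℕ.+ n)
  packing y = positionBin (σ-perm ⟨$⟩ˡ y)

  packing-σ : ∀ p → packing (σ p) ≡ positionBin p
  packing-σ p = cong positionBin (inverseˡ σ-perm)

  binCount-packing : ∀ j → binCount packing j ≡ binCount positionBin j
  binCount-packing j = trans (sym (binCount-permute σ-perm packing j)) (binCount-cong packing-σ j)

  binLoad-packing : ∀ r j → binLoad r packing j ≡ binLoad (r ∘ σ) positionBin j
  binLoad-packing r j = trans (sym (binLoad-permute σ-perm r packing j)) (binLoad-cong (λ _ → refl) packing-σ j)

  packing-sparse : ∀ j (p : Fin n) → packing (σ p) ≡ j → InΨ k Π breakpoints (toℕ p) →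
                   (∀ (q : Fin n) → packing (σ q) ≡ j → InΨ k Π breakpoints (toℕ q)) × (binCount packing j ℕ.≤ k ℕ.* k)
  packing-sparse j p p↦j p∈Ψ =
    let same-bin , small = sparse-positionBin p (trans (sym (packing-σ p)) p↦j) (InΨ⇒Ψ p∈Ψ) in
    (λ q q↦j → Ψ⇒InΨ (same-bin q (trans (sym (packing-σ q)) q↦j))) ,
    subst (ℕ._≤ k ℕ.* k) (sym (binCount-packing j)) small

  packing-dense : ∀ j (p : Fin n) → packing (σ p) ≡ j → ¬ InΨ k Π breakpoints (toℕ p) →
                  (∀ (q : Fin n) → packing (σ q) ≡ j → ¬ InΨ k Π breakpoints (toℕ q)) × (k ℕ.* k ℕ.< binCount packing j)
  packing-dense j p p↦j p∉Ψ =
    let same-bin , large = dense-positionBin p (trans (sym (packing-σ p)) p↦j) (p∉Ψ ∘ Ψ⇒InΨ) in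
    (λ q q↦j → same-bin q (trans (sym (packing-σ q)) q↦j) ∘ InΨ⇒Ψ) ,
    subst (k ℕ.* k ℕ.<_) (sym (binCount-packing j)) large

  later-block : ∀ {x} → Ψ x → ¬ Ψ₀ x → ∃[ i ] 0 ℕ.< i × i ℕ.< cube k × InBlock (t i) (groupSize i) x
  later-block (zero  , _   , x∈Γ) x∉Ψ₀ = contradiction x∈Γ x∉Ψ₀
  later-block (suc i , i<m , x∈Γ) _    = suc i , ℕ.z<s , i<m , x∈Γ

  blockHead : ∀ {i} p → InBlock (t i) (groupSize i) (toℕ p) → Fin n
  blockHead p (t≤p , _) = fromℕ< (ℕ.≤-<-trans t≤p (toℕ<n p))

  toℕ-blockHead : ∀ {i} p (p∈Γ : InBlock (t i) (groupSize i) (toℕ p)) → toℕ (blockHead p p∈Γ) ≡ t i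
  toℕ-blockHead p (t≤p , _) = toℕ-fromℕ< (ℕ.≤-<-trans t≤p (toℕ<n p))

  module Rounded (r : Fin n → ℚ)
    (r-block : ∀ i (p q : Fin n) → breakpoints (Fin.inject₁ i) ℕ.≤ toℕ p →
               toℕ p ℕ.< breakpoints (Fin.inject₁ i) ℕ.+ piSize k Π i →
               toℕ q ≡ breakpoints (Fin.inject₁ i) → r (σ p) ≡ s (σ q))
    (r-∉Ψ : ∀ (p : Fin n) → ¬ InΨ k Π breakpoints (toℕ p) → r (σ p) ≡ s (σ p)) where

    r-blockHead : ∀ {i} → i ℕ.< cube k → ∀ p (p∈Γ : InBlock (t i) (groupSize i) (toℕ p)) →
                  r (σ p) ≡ s (σ (blockHead p p∈Γ))
    r-blockHead i<m p p∈Γ = r-block (fromℕ< i<m) p (blockHead p p∈Γ) (proj₁ p∈Γ′) (proj₂ p∈Γ′)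
      (trans (toℕ-blockHead p p∈Γ) (cong t (sym (toℕ-inject₁-fromℕ< i<m))))
      where p∈Γ′ = inBlock-fromℕ< i<m p∈Γ

    r-≤-later : ∀ {i} p → 0 ℕ.< i → i ℕ.< cube k → InBlock (t i) (groupSize i) (toℕ p) → r (σ p) ℚ.≤ s (σ (match p))
    r-≤-later p 0<i i<m p∈Γ = ℚ.≤-trans (ℚ.≤-reflexive (r-blockHead i<m p p∈Γ)) (sortedOrder-antitone {s = s} sorted match≤head)
      where
      match≤head : toℕ (match p) ℕ.≤ toℕ (blockHead p p∈Γ)
      match≤head = ℕ.≤-trans (ℕ.<⇒≤ (match-later-block-< p 0<i i<m p∈Γ)) (ℕ.≤-reflexive (sym (toℕ-blockHead p p∈Γ)))

    r-≤-matched : ∀ p → ¬ Ψ₀ (toℕ p) → r (σ p) ℚ.≤ s (σ (match p))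
    r-≤-matched p p∉Ψ₀ = go (Ψ? (toℕ p))
      where
      go : Dec (Ψ (toℕ p)) → r (σ p) ℚ.≤ s (σ (match p))
      go (no p∉Ψ)  = ℚ.≤-trans (ℚ.≤-reflexive (r-∉Ψ p (p∉Ψ ∘ InΨ⇒Ψ)))
                               (sortedOrder-antitone {s = s} sorted (match-∉Ψ-≤ p p∉Ψ))
      go (yes p∈Ψ) = let i , 0<i , i<m , p∈Γ = later-block p∈Ψ p∉Ψ₀ in r-≤-later p 0<i i<m p∈Γ

    r-Ψ₀-bounds : ∀ p → Ψ₀ (toℕ p) → (0ℚ ℚ.≤ r (σ p)) × (r (σ p) ℚ.≤ 1ℚ)
    r-Ψ₀-bounds p p∈Ψ₀ rewrite r-blockHead (ℕ.>-nonZero⁻¹ (cube k)) p p∈Ψ₀ = s-bounds (σ (blockHead p p∈Ψ₀))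

    positionBin-feasible : Feasible s O → ∀ j → binLoad (r ∘ σ) positionBin j ℚ.≤ 1ℚ
    positionBin-feasible O-feasible j with splitLabel {kO} {n} j
    ... | left j′ = begin
      binLoad (r ∘ σ) positionBin (j′ ↑ˡ n)   ≤⟨ binLoad-≤ (r ∘ σ) (s ∘ σ ∘ match) positionBin matchedBin
                                                   (λ p eq → proj₂ (in-old-bin eq) , r-≤-matched p (proj₁ (in-old-bin eq)))
                                                   (λ p → proj₁ (s-bounds (σ (match p)))) ⟩
      binLoad (s ∘ σ ∘ match) matchedBin j′   ≡⟨ binLoad-permute matched-permutation s O j′ ⟩
      binLoad s O j′                          ≤⟨ O-feasible j′ ⟩
      1ℚ                                      ∎
      where open ℚ.≤-Reasoning
    ... | right q = go (Ψ₀? (toℕ q))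
      where
      go : Dec (Ψ₀ (toℕ q)) → binLoad (r ∘ σ) positionBin (kO ↑ʳ q) ℚ.≤ 1ℚ
      go (yes q∈Ψ₀) = ℚ.≤-trans
        (binLoad-singleton (r ∘ σ) positionBin q (proj₁ (r-Ψ₀-bounds q q∈Ψ₀)) (λ p eq → proj₁ (in-fresh-bin eq)))
        (proj₂ (r-Ψ₀-bounds q q∈Ψ₀))
      go (no q∉Ψ₀)  = ℚ.≤-trans
        (ℚ.≤-reflexive (binLoad-empty (r ∘ σ) positionBin (λ p eq → q∉Ψ₀ (proj₂ (in-fresh-bin eq)))))
        (ℚ.nonNegative⁻¹ 1ℚ)

    packing-feasible : Feasible s O → Feasible r packing
    packing-feasible O-feasible j = subst (ℚ._≤ 1ℚ) (sym (binLoad-packing r j)) (positionBin-feasible O-feasible j)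

  NonemptySparseBin : Pred (Fin kO) 0ℓ
  NonemptySparseBin j = 1 ℕ.≤ binCount O j × SparseBin j

  nonemptySparseBin? : Decidable NonemptySparseBin
  nonemptySparseBin? j = (1 ℕ.≤? binCount O j) ×-dec sparseBin? j

  nonemptySparseBins : ℕ
  nonemptySparseBins = sum (λ j → indicator (nonemptySparseBin? j))

  Π≤k²*nonemptySparseBins : Π ℕ.≤ k ℕ.* k ℕ.* nonemptySparseBins
  Π≤k²*nonemptySparseBins = begin
    count sparseAt? n                                             ≡⟨ count≡sum sparseAt? n ⟩
    sum {n} (λ p → indicator (sparseAt? (toℕ p)))
      ≡⟨ sum-cong-≗ {n} (λ p → indicator-cong (sparseAt⁻ p) (sparseAt⁺ p) _ _) ⟩
    sum {n} (λ p → indicator (sparseBin? (O (σ p))))              ≡⟨ sum-permute (λ x → indicator (sparseBin? (O x))) σ-perm ⟨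
    sum {n} (λ x → indicator (sparseBin? (O x)))                  ≡⟨ sum-binCount O (λ j → indicator (sparseBin? j)) ⟩
    sum {kO} (λ j → indicator (sparseBin? j) ℕ.* binCount O j)    ≤⟨ sum-mono-≤ (λ j → weight (sparseBin? j) (nonemptySparseBin? j)) ⟩
    sum {kO} (λ j → k ℕ.* k ℕ.* indicator (nonemptySparseBin? j))
      ≡⟨ *-distribˡ-sum (k ℕ.* k) (λ j → indicator (nonemptySparseBin? j)) ⟨
    k ℕ.* k ℕ.* nonemptySparseBins                                ∎
    where
    open ℕ.≤-Reasoning
    weight : ∀ {j} (d : Dec (SparseBin j)) (e : Dec (NonemptySparseBin j)) →
             indicator d ℕ.* binCount O j ℕ.≤ k ℕ.* k ℕ.* indicator e
    weight         (no _)      _              = z≤n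
    weight {j} (yes sparse) (yes _)        = subst₂ ℕ._≤_ (sym (ℕ.*-identityˡ (binCount O j))) (sym (ℕ.*-identityʳ (k ℕ.* k))) sparse
    weight {j} (yes sparse) (no ¬nonempty) = subst (ℕ._≤ k ℕ.* k ℕ.* 0) (sym (ℕ.*-identityˡ (binCount O j))) empty
      where
      empty : binCount O j ℕ.≤ k ℕ.* k ℕ.* 0
      empty = ℕ.≤-trans (ℕ.≮⇒≥ (λ nonempty → ¬nonempty (nonempty , sparse))) z≤n

  module Cost (f : ℕ → ℚ) (cf : CostFunction n f) where

    private
      f-0 : f 0 ≡ 0ℚ
      f-0 = proj₁ cf
      f-1 : f 1 ≡ 1ℚ
      f-1 = proj₁ (proj₂ cf)
      f-nonneg : ∀ x → x ℕ.≤ n → 0ℚ ℚ.≤ f x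
      f-nonneg = proj₁ (proj₂ (proj₂ cf))
      f-mono : ∀ x y → x ℕ.≤ y → y ℕ.≤ n → f x ℚ.≤ f y
      f-mono = proj₂ (proj₂ (proj₂ cf))

    nonemptySparseBins≤cost : toℚ nonemptySparseBins ℚ.≤ cost f O
    nonemptySparseBins≤cost = begin
      toℚ nonemptySparseBins                                ≡⟨ sumℚ-toℚ (λ j → indicator (nonemptySparseBin? j)) ⟨
      sumℚ (λ j → toℚ (indicator (nonemptySparseBin? j)))   ≤⟨ sumℚ-mono-≤ (λ j → each j (nonemptySparseBin? j)) ⟩
      cost f O                                              ∎
      where
      open ℚ.≤-Reasoning
      each : ∀ j (d : Dec (NonemptySparseBin j)) → toℚ (indicator d) ℚ.≤ f (binCount O j)
      each j (yes (nonempty , _)) = ℚ.≤-trans (ℚ.≤-reflexive (sym f-1)) (f-mono 1 _ nonempty (binCount-≤-n O j))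
      each j (no _)               = f-nonneg _ (binCount-≤-n O j)

    k*firstGroup≤ : k ℕ.* groupSize 0 ℕ.≤ nonemptySparseBins ℕ.+ k
    k*firstGroup≤ = begin
      k ℕ.* groupSize 0                       ≤⟨ ℕ.*-monoʳ-≤ k groupSize-first-≤ ⟩
      k ℕ.* (Π / cube k ℕ.+ 1)                ≡⟨ ℕ.*-distribˡ-+ k (Π / cube k) 1 ⟩
      k ℕ.* (Π / cube k) ℕ.+ k ℕ.* 1          ≤⟨ ℕ.+-mono-≤ k*quotient≤ (ℕ.≤-reflexive (ℕ.*-identityʳ k)) ⟩
      nonemptySparseBins ℕ.+ k                ∎
      where
      open ℕ.≤-Reasoning
      k*quotient≤ : k ℕ.* (Π / cube k) ℕ.≤ nonemptySparseBins
      k*quotient≤ = ℕ.*-cancelˡ-≤ (k ℕ.* k) (begin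
        k ℕ.* k ℕ.* (k ℕ.* (Π / cube k))    ≡⟨ ℕ.*-assoc (k ℕ.* k) k (Π / cube k) ⟨
        cube k ℕ.* (Π / cube k)             ≡⟨ ℕ.*-comm (cube k) (Π / cube k) ⟩
        Π / cube k ℕ.* cube k               ≤⟨ m/n*n≤m Π (cube k) ⟩
        Π                                   ≤⟨ Π≤k²*nonemptySparseBins ⟩
        k ℕ.* k ℕ.* nonemptySparseBins      ∎)

    cost-packing-≤ : cost f packing ℚ.≤ cost f O ℚ.+ toℚ (groupSize 0)
    cost-packing-≤ = begin
      cost f packing                                                           ≡⟨ sumℚ-cong (λ j → cong f (binCount-packing j)) ⟩
      sumℚ (λ j → f (binCount positionBin j))                                  ≡⟨ sumℚ-↑ kO (λ j → f (binCount positionBin j)) ⟩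
      sumℚ (λ j → f (binCount positionBin (j ↑ˡ n))) ℚ.+ sumℚ (λ q → f (binCount positionBin (kO ↑ʳ q)))
        ≤⟨ ℚ.+-mono-≤ (sumℚ-mono-≤ old-bin) (sumℚ-mono-≤ (λ q → fresh-bin q (Ψ₀? (toℕ q)))) ⟩
      cost f O ℚ.+ sumℚ {n} (λ q → toℚ (indicator (Ψ₀? (toℕ q))))
        ≡⟨ cong (cost f O ℚ.+_) (sumℚ-toℚ {n} (λ q → indicator (Ψ₀? (toℕ q)))) ⟩
      cost f O ℚ.+ toℚ (sum {n} (λ q → indicator (Ψ₀? (toℕ q))))
        ≡⟨ cong (λ c → cost f O ℚ.+ toℚ c) (count≡sum Ψ₀? n) ⟨
      cost f O ℚ.+ toℚ (count Ψ₀? n)                                          ≤⟨ ℚ.+-monoʳ-≤ (cost f O) (toℚ-mono-≤ count-Ψ₀) ⟩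
      cost f O ℚ.+ toℚ (groupSize 0)                                          ∎
      where
      open ℚ.≤-Reasoning
      old-bin : ∀ j → f (binCount positionBin (j ↑ˡ n)) ℚ.≤ f (binCount O j)
      old-bin j = f-mono _ _ (binCount-old-≤ j) (binCount-≤-n O j)
      fresh-bin : ∀ q (d : Dec (Ψ₀ (toℕ q))) → f (binCount positionBin (kO ↑ʳ q)) ℚ.≤ toℚ (indicator d)
      fresh-bin q (yes _)    = ℚ.≤-trans (f-mono _ 1 (binCount-singleton positionBin q (λ p eq → proj₁ (in-fresh-bin eq)))
                                                     (ℕ.≤-trans (s≤s z≤n) (toℕ<n q)))
                                         (ℚ.≤-reflexive f-1)
      fresh-bin q (no q∉Ψ₀) =
        ℚ.≤-reflexive (trans (cong f (binCount-empty positionBin (λ p eq → q∉Ψ₀ (proj₂ (in-fresh-bin eq))))) f-0)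

    cost-packing-bound : cost f packing ℚ.≤ (1ℚ ℚ.+ (+ 1) ℚ./ k) ℚ.* cost f O ℚ.+ 1ℚ
    cost-packing-bound = begin
      cost f packing                                      ≤⟨ cost-packing-≤ ⟩
      cost f O ℚ.+ toℚ (groupSize 0)
        ≤⟨ ℚ.+-monoʳ-≤ (cost f O) (toℚ-≤-/-+1 k k*firstGroup≤ nonemptySparseBins≤cost) ⟩
      cost f O ℚ.+ ((+ 1) ℚ./ k ℚ.* cost f O ℚ.+ 1ℚ)     ≡⟨ p+[q*p+1]≡[1+q]*p+1 (cost f O) ((+ 1) ℚ./ k) ⟩
      (1ℚ ℚ.+ (+ 1) ℚ./ k) ℚ.* cost f O ℚ.+ 1ℚ           ∎
      where open ℚ.≤-Reasoning

lemma1 :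
  (k : ℕ) → .{{_ : NonZero k}} →
  (n : ℕ) → (s : Fin n → ℚ) →
  (∀ i → (0ℚ ℚ.≤ s i) × (s i ℚ.≤ 1ℚ)) →
  (f : ℕ → ℚ) → CostFunction n f →
  (σ : Fin n → Fin n) → SortedOrder s σ →
  (kO : ℕ) → (O : Fin n → Fin kO) → Feasible s O →
  (∀ (kP : ℕ) (P : Fin n → Fin kP) → Feasible s P → cost f O ℚ.≤ cost f P) →
  Σ ℕ λ Π → Σ (Fin (suc (cube k)) → ℕ) λ t →
    (Π ℕ.≤ n)
    × (t (Fin.fromℕ (cube k)) ≡ n)
    × (∀ i → t (Fin.inject₁ i) ℕ.≤ t (Fin.suc i))
    × (∀ i → t (Fin.inject₁ i) ℕ.+ piSize k Π i ℕ.≤ t (Fin.suc i))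
    × ((r : Fin n → ℚ) →
       (∀ i (p q : Fin n) → t (Fin.inject₁ i) ℕ.≤ toℕ p →
          toℕ p ℕ.< t (Fin.inject₁ i) ℕ.+ piSize k Π i →
          toℕ q ≡ t (Fin.inject₁ i) → r (σ p) ≡ s (σ q)) →
       (∀ (p : Fin n) → ¬ InΨ k Π t (toℕ p) → r (σ p) ≡ s (σ p)) →
       Σ ℕ λ kA → Σ (Fin n → Fin kA) λ a →
         Feasible r a
         × (∀ j (p : Fin n) → a (σ p) ≡ j → InΨ k Π t (toℕ p) →
              (∀ (q : Fin n) → a (σ q) ≡ j → InΨ k Π t (toℕ q))
              × (binCount a j ℕ.≤ k ℕ.* k))
         × (∀ j (p : Fin n) → a (σ p) ≡ j → ¬ InΨ k Π t (toℕ p) →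
              (∀ (q : Fin n) → a (σ q) ≡ j → ¬ InΨ k Π t (toℕ q))
              × (k ℕ.* k ℕ.< binCount a j))
         × (cost f a ℚ.≤ (1ℚ ℚ.+ (+ 1) ℚ./ k) ℚ.* cost f O ℚ.+ 1ℚ))
lemma1 k n s s-bounds f cf σ sorted kO O O-feasible _ =
  Π , breakpoints , count-≤ sparseAt? n , breakpoints-last , breakpoints-mono , breakpoints-ordered ,
  λ r r-block r-∉Ψ → kO ℕ.+ n , packing ,
    Rounded.packing-feasible r r-block r-∉Ψ O-feasible , packing-sparse , packing-dense , Cost.cost-packing-bound f cf
  where open Construction k n s s-bounds σ sorted kO O
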